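{- Let $S=\{x_1,\dots,x_n\}$ be a gcd-closed set of distinct positive integers satisfying the condition $\mathcal G$, let $x_l,x_m\in S$ with $|G_S(x_m)|=3$, and let $a,b$ be positive integers with $a\mid b$. Define $$f(l,m)=\frac{1}{\alpha_{\xi_a}(x_m)}\sum_{\substack{1\le r\le n\\ x_r\mid x_m}}c_{rm}(x_l,x_r)^b,\qquad g(l,m)=\frac{1}{\alpha_{\xi_a}(x_m)}\sum_{\substack{1\le r\le n\\ x_r\mid x_m}}c_{rm}[x_l,x_r]^b.$$ Then $f(l,m)\in\mathbb Z$ and $g(l,m)\in\mathbb Z$.
   Context: $(x,y)$, $[x,y]$ denote gcd and lcm. $S$ is gcd closed if $(x_i,x_j)\in S$ for all $i,j$. For $x,y\in S$ with $x<y$, $x$ is a greatest-type divisor of $y$ in $S$ if $x\mid y$ and the conditions $x\mid d\mid y$, $d\in S$ imply $d\in\{x,y\}$; $G_S(y)$ is the set of greatest-type divisors of $y$ in $S$. For $x\in S$ with $|G_S(x)|\ge2$, two distinct $y_1,y_2\in G_S(x)$ satisfy the condition $\mathcal G$ if $[y_1,y_2]=x$ and $(y_1,y_2)\in G_S(y_1)\cap G_S(y_2)$; $x$ satisfies $\mathcal G$ if any two distinct elements of $G_S(x)$ do; $S$ satisfies $\mathcal G$ if every $x\in S$ has $|G_S(x)|\le1$ or satisfies $\mathcal G$. $\mu$ is the Möbius function, $\xi_a(x)=x^a$, $(\xi_a*\mu)(d)=\sum_{e\mid d}e^a\mu(d/e)$, and $\alpha_{\xi_a}(x_m)=\sum(\xi_a*\mu)(d)$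 over positive divisors $d$ of $x_m$ with $d\nmid x_t$ for all $x_t\in S$ with $x_t<x_m$. $c_{rm}=\sum\mu(d)$ over positive integers $d$ with $dx_r\mid x_m$ and $dx_r\nmid x_t$ for all $x_t\in S$ with $x_t<x_m$. -}

module Defs where

open import Data.Nat as ℕ using (ℕ; zero; suc; _<_; _≤_; _<?_; _≟_; _*_; _^_)
open import Data.Nat.Divisibility using (_∣_; _∣?_)
open import Data.Nat.GCD using (gcd)
open import Data.Nat.LCM using (lcm)
open import Data.Nat.Primality using (Prime; prime?)
open import Data.Integer as ℤ using (ℤ; +_; -_)
open import Data.Fin using (Fin)
open import Data.Fin.Properties using (all?)
open import Data.List using (List; []; _∷_; map; filter; upTo; allFin; length; cartesianProduct; foldr)
open import Data.Product using (_×_; _,_; proj₁; proj₂; ∃)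
open import Data.Sum using (_⊎_)
open import Relation.Nullary using (¬_; Dec; yes; no; does)
open import Relation.Nullary.Decidable using (_→-dec_; ¬?; _×-dec_)
open import Relation.Binary.PropositionalEquality using (_≡_)
open import Data.Bool using (if_then_else_)

Σℤ : List ℤ → ℤ
Σℤ = foldr ℤ._+_ (+ 0)

[1‥_] : ℕ → List ℕ
[1‥ k ] = map suc (upTo k)

-- Möbius function (standard definition):
-- μ(d) = 0 if some k ≥ 2 has k² ∣ d, otherwise (-1)^(number of primes dividing d).
-- Only used for d ≥ 1.

squareDivides? : (d k : ℕ) → Dec ((2 ≤ k) × (k * k ∣ d))
squareDivides? d k = (2 ℕ.≤? k) ×-dec ((k * k) ∣? d)

primeDivides? : (d p : ℕ) → Dec (Prime p × (p ∣ d))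
primeDivides? d p = prime? p ×-dec (p ∣? d)

μ : ℕ → ℤ
μ d with length (filter (squareDivides? d) [1‥ d ])
... | suc _ = + 0
... | zero  = (ℤ.-1ℤ) ℤ.^ length (filter (primeDivides? d) [1‥ d ])

-- (ξ_a * μ)(d) = Σ_{e ∣ d} e^a μ(d/e), written as a sum over pairs (e , f)
-- of positive integers with e * f = d.
ξ*μ : ℕ → ℕ → ℤ
ξ*μ a d =
  Σℤ (map (λ ef → (+ (proj₁ ef ^ a)) ℤ.* μ (proj₂ ef))
          (filter (λ ef → (proj₁ ef * proj₂ ef) ≟ d)
                  (cartesianProduct [1‥ d ] [1‥ d ])))

-- The set S = {x 0, …, x (n-1)} is given by an indexing x : Fin n → ℕ.

module _ {n : ℕ} (x : Fin n → ℕ) where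

  NoSmaller : Fin n → ℕ → Set
  NoSmaller m d = ∀ t → x t < x m → ¬ (d ∣ x t)

  noSmaller? : ∀ m d → Dec (NoSmaller m d)
  noSmaller? m d = all? (λ t → (x t <? x m) →-dec ¬? (d ∣? x t))

  α : ℕ → Fin n → ℤ
  α a m = Σℤ (map (ξ*μ a)
                  (filter (λ d → (d ∣? x m) ×-dec noSmaller? m d) [1‥ x m ]))

  -- c_{rm}: sum of μ(d) over positive d with d x_r ∣ x_m and
  -- d x_r ∤ x_t for all x_t ∈ S with x_t < x_m.  (Such d satisfy d ≤ x_m.)
  c : Fin n → Fin n → ℤ
  c r m = Σℤ (map μ
                  (filter (λ d → ((d * x r) ∣? x m) ×-dec noSmaller? m (d * x r))
                          [1‥ x m ]))

  divIdx : Fin n → List (Fin n)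
  divIdx m = filter (λ r → x r ∣? x m) (allFin n)

  sumGcd : ℕ → Fin n → Fin n → ℤ
  sumGcd b l m = Σℤ (map (λ r → c r m ℤ.* (+ (gcd (x l) (x r) ^ b))) (divIdx m))

  sumLcm : ℕ → Fin n → Fin n → ℤ
  sumLcm b l m = Σℤ (map (λ r → c r m ℤ.* (+ (lcm (x l) (x r) ^ b))) (divIdx m))

  GcdClosed : Set
  GcdClosed = ∀ i j → ∃ λ k → x k ≡ gcd (x i) (x j)

  GreatestType : Fin n → Fin n → Set
  GreatestType i j =
    x i < x j × x i ∣ x j ×
    (∀ k → x i ∣ x k → x k ∣ x j → (x k ≡ x i) ⊎ (x k ≡ x j))

  HasThreeGTD : Fin n → Set
  HasThreeGTD m = ∃ λ i → ∃ λ j → ∃ λ k →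
    ¬ (x i ≡ x j) × ¬ (x i ≡ x k) × ¬ (x j ≡ x k) ×
    GreatestType i m × GreatestType j m × GreatestType k m ×
    (∀ y → GreatestType y m → (x y ≡ x i) ⊎ (x y ≡ x j) ⊎ (x y ≡ x k))

  -- S satisfies condition 𝒢: for every x_z ∈ S and any two distinct
  -- y₁ = x_i, y₂ = x_j in G_S(x_z): [y₁,y₂] = x_z and (y₁,y₂) ∈ G_S(y₁) ∩ G_S(y₂).
  -- (When |G_S(x_z)| ≤ 1 there are no two distinct elements, so this is
  -- exactly "|G_S(x_z)| ≤ 1 or x_z satisfies 𝒢".)
  SatisfiesG : Set
  SatisfiesG = ∀ z i j → GreatestType i z → GreatestType j z → ¬ (x i ≡ x j) →
    (lcm (x i) (x j) ≡ x z) ×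
    (∃ λ k → (x k ≡ gcd (x i) (x j)) × GreatestType k i × GreatestType k j)

module Submission where

-- Let N = x_m and y₁, y₂, y₃ its greatest-type divisors. Möbius inversion over the divisor
-- lattice turns both α_{ξ_a}(x_m) and Σ_{x_r ∣ N} c_{rm} h(x_r) into the inclusion–exclusion sum
-- Δ³ h = h(N) − Σ h(yᵢ) + Σ h(yᵢ ∧ yⱼ) − h(y₁ ∧ y₂ ∧ y₃), with h = ξ_a, resp. h(M) = (x_l, M)^b
-- or [x_l, M]^b. Condition 𝒢 makes N = A y₁ and y₂, y₃, y₂ ∧ y₃ equal to A times y₁ ∧ y₂,
-- y₁ ∧ y₃, y₁ ∧ y₂ ∧ y₃, so Δ³ ξ_e = (A^e − 1) Δ² ξ_e for the square sum Δ² over y₁, y₁ ∧ y₂,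
-- y₁ ∧ y₃, w = y₁ ∧ y₂ ∧ y₃, and 𝒢 once more gives Δ² ξ_e = w^e (B^e − 1)(C^e − 1); for a ∣ b
-- each factor at e = a divides the one at e = b. For the gcd and lcm sums, u = (x_l, N) ∈ S is
-- either N or lies below some yᵢ; in each case the sum either vanishes or factors in the same
-- way, the lcm square being handled by the same dichotomy one level down.

open import Defs
open import Data.Nat using (ℕ; _<_)
open import Data.Nat.Divisibility using (_∣_)
open import Data.Integer using (ℤ; _*_)
open import Data.Fin using (Fin)
open import Data.Product using (_×_; ∃)
open import Function.Definitions using (Injective)
open import Relation.Binary.PropositionalEquality using (_≡_)

open import Data.Bool using (Bool; true; false; not; _∧_)
open import Data.Empty using (⊥-elim)
open import Data.Fin as Fin using ()
open import Data.Fin.Properties using (any?; suc-injective)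
open import Data.Integer as ℤ using (+_; -_; 0ℤ; 1ℤ; -1ℤ; _+_; _-_; _^_)
import Data.Integer.Divisibility.Signed as ℤ∣
open ℤ∣ using () renaming (_∣_ to _∣ℤ_)
import Data.Integer.Properties as ℤP
open import Algebra.Properties.CommutativeSemigroup ℤP.+-commutativeSemigroup using () renaming (interchange to +-interchange)
open import Data.Integer.Tactic.RingSolver using (solve-∀)
open import Data.List using (List; []; _∷_; map; filter; upTo; allFin; tabulate; cartesianProduct; length; _++_)
import Data.List.Properties as ListP
import Data.List.Relation.Unary.All as All
open import Data.Nat as ℕ using (zero; suc; _≤_; z≤n; s≤s; NonZero)
open import Data.Nat.Coprimality using (Coprime; coprime-divisor)
open import Data.Nat.Divisibility
  using (divides; _∣?_; 0∣⇒≡0; ∣-refl; ∣-reflexive; ∣-trans; ∣-antisym; ∣⇒≤; ∣1⇒≡1; ∣m+n∣m⇒∣n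
        ; n∣m*n; m∣m*n; ∣m⇒∣m*n; ∣n⇒∣m*n; *-monoˡ-∣; *-cancelˡ-∣; *-cancelʳ-∣)
open import Data.Nat.GCD using (gcd; gcd[m,n]∣m; gcd[m,n]∣n; gcd-greatest; gcd-comm; c*gcd[m,n]≡gcd[cm,cn]; gcd[m,n]≡0⇒m≡0)
open import Data.Nat.Induction using (<-wellFounded)
open import Data.Nat.LCM using (lcm; m∣lcm[m,n]; n∣lcm[m,n]; lcm-least; gcd*lcm)
open import Data.Nat.Primality using (Prime; euclidsLemma; prime⇒irreducible; ¬prime[1]; prime⇒nonZero; prime⇒nonTrivial)
open import Data.Nat.Primality.Factorisation using (factorise)
import Data.Nat.Properties as ℕP
open import Data.Nat.Tactic.RingSolver using () renaming (solve-∀ to solve-∀ℕ)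
open import Data.Product using (_,_; proj₁; proj₂)
open import Data.Sum using (_⊎_; inj₁; inj₂)
open import Data.Unit using (⊤; tt)
open import Function.Bundles using (_⇔_; mk⇔)
open import Induction.WellFounded using (Acc; acc)
open import Level using (0ℓ)
open import Relation.Binary.PropositionalEquality using (refl; sym; trans; cong; cong₂; subst; subst₂; module ≡-Reasoning)
open import Relation.Nullary using (¬_; Dec; yes; no; does)
open import Relation.Nullary.Decidable using (dec-true; dec-false; does-⇔; ¬?; _×-dec_)
open import Relation.Unary using (Pred; Decidable)

-- Indicators and finite sums

χ : Bool → ℤ → ℤ
χ true  v = v
χ false _ = 0ℤ

χ-dec-true : ∀ {A : Set} (a? : Dec A) {v} → A → χ (does a?) v ≡ v
χ-dec-true a? a rewrite dec-true a? a = refl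

χ-dec-false : ∀ {A : Set} (a? : Dec A) {v} → ¬ A → χ (does a?) v ≡ 0ℤ
χ-dec-false a? ¬a rewrite dec-false a? ¬a = refl

χ≢0⇒holds : ∀ {A : Set} (a? : Dec A) {v} → ¬ χ (does a?) v ≡ 0ℤ → A
χ≢0⇒holds (yes a) χ≢0 = a
χ≢0⇒holds (no _)  χ≢0 = ⊥-elim (χ≢0 refl)

χ-zero : ∀ b → χ b 0ℤ ≡ 0ℤ
χ-zero true  = refl
χ-zero false = refl

χ-distrib-+ : ∀ b u v → χ b (u + v) ≡ χ b u + χ b v
χ-distrib-+ true  u v = refl
χ-distrib-+ false u v = refl

χ-*ˡ : ∀ b c v → χ b (c * v) ≡ c * χ b v
χ-*ˡ true  c v = refl
χ-*ˡ false c v = sym (ℤP.*-zeroʳ c)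

χ≡χ1* : ∀ b v → χ b v ≡ χ b 1ℤ * v
χ≡χ1* true  v = sym (ℤP.*-identityˡ v)
χ≡χ1* false v = sym (ℤP.*-zeroˡ v)

χ-comm : ∀ a b v → χ a (χ b v) ≡ χ b (χ a v)
χ-comm true  b v = refl
χ-comm false b v = sym (χ-zero b)

χ-split : ∀ b v → v ≡ χ b v + χ (not b) v
χ-split true  v = sym (ℤP.+-identityʳ v)
χ-split false v = sym (ℤP.+-identityˡ v)

χ-inverseˡ : ∀ b v → χ b (- v) + χ b v ≡ 0ℤ
χ-inverseˡ true  v = ℤP.+-inverseˡ v
χ-inverseˡ false v = refl

0≤χ1 : ∀ b → 0ℤ ℤ.≤ χ b 1ℤ
0≤χ1 true  = ℤ.+≤+ z≤n
0≤χ1 false = ℤ.+≤+ z≤n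

Σℤ-++ : ∀ xs ys → Σℤ (xs ++ ys) ≡ Σℤ xs + Σℤ ys
Σℤ-++ []       ys = sym (ℤP.+-identityˡ _)
Σℤ-++ (x ∷ xs) ys = trans (cong (_+_ x) (Σℤ-++ xs ys)) (sym (ℤP.+-assoc x _ _))

Σℤ-map-filter : ∀ {A : Set} {P : Pred A 0ℓ} (P? : Decidable P) (f : A → ℤ) xs →
  Σℤ (map f (filter P? xs)) ≡ Σℤ (map (λ i → χ (does (P? i)) (f i)) xs)
Σℤ-map-filter P? f [] = refl
Σℤ-map-filter P? f (x ∷ xs) with does (P? x)
... | true  = cong (_+_ (f x)) (Σℤ-map-filter P? f xs)
... | false = trans (Σℤ-map-filter P? f xs) (sym (ℤP.+-identityˡ _))

Σℤ-map-+ : ∀ {A : Set} (xs : List A) f g → Σℤ (map (λ e → f e + g e) xs) ≡ Σℤ (map f xs) + Σℤ (map g xs)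
Σℤ-map-+ []       f g = refl
Σℤ-map-+ (x ∷ xs) f g = trans (cong (_+_ (f x + g x)) (Σℤ-map-+ xs f g)) (+-interchange (f x) (g x) _ _)

Σℤ-map-neg : ∀ {A : Set} (xs : List A) f → Σℤ (map (λ e → - f e) xs) ≡ - Σℤ (map f xs)
Σℤ-map-neg []       f = refl
Σℤ-map-neg (x ∷ xs) f = trans (cong (_+_ (- f x)) (Σℤ-map-neg xs f)) (sym (ℤP.neg-distrib-+ (f x) _))

Σℤ-map-zero : ∀ {A : Set} (xs : List A) f → (∀ r → f r ≡ 0ℤ) → Σℤ (map f xs) ≡ 0ℤ
Σℤ-map-zero []       f f≡0 = refl
Σℤ-map-zero (x ∷ xs) f f≡0 = cong₂ _+_ (f≡0 x) (Σℤ-map-zero xs f f≡0)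

Σℤ-map-const1 : ∀ {A : Set} (xs : List A) → Σℤ (map (λ _ → 1ℤ) xs) ≡ + length xs
Σℤ-map-const1 []       = refl
Σℤ-map-const1 (x ∷ xs) = trans (cong (_+_ 1ℤ) (Σℤ-map-const1 xs)) (sym (ℤP.pos-+ 1 (length xs)))

Σℤ-cartesianProduct : ∀ {A B : Set} (F : A × B → ℤ) xs ys →
  Σℤ (map F (cartesianProduct xs ys)) ≡ Σℤ (map (λ x → Σℤ (map (λ y → F (x , y)) ys)) xs)
Σℤ-cartesianProduct F []       ys = refl
Σℤ-cartesianProduct F (x ∷ xs) ys = begin
  Σℤ (map F (map (x ,_) ys ++ cartesianProduct xs ys))
    ≡⟨ cong Σℤ (ListP.map-++ F (map (x ,_) ys) _) ⟩
  Σℤ (map F (map (x ,_) ys) ++ map F (cartesianProduct xs ys))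
    ≡⟨ Σℤ-++ (map F (map (x ,_) ys)) _ ⟩
  Σℤ (map F (map (x ,_) ys)) + Σℤ (map F (cartesianProduct xs ys))
    ≡⟨ cong₂ _+_ (cong Σℤ (sym (ListP.map-∘ ys))) (Σℤ-cartesianProduct F xs ys) ⟩
  Σℤ (map (λ y → F (x , y)) ys) + Σℤ (map (λ x → Σℤ (map (λ y → F (x , y)) ys)) xs) ∎
  where open ≡-Reasoning

Σℤ-allFin-single : ∀ n (F : Fin n → ℤ) k → (∀ r → ¬ r ≡ k → F r ≡ 0ℤ) → Σℤ (map F (allFin n)) ≡ F k
Σℤ-allFin-single (suc n) F k F≡0 = trans (cong (λ xs → F Fin.zero + Σℤ xs) allFin-suc) (split k F≡0)
  where
  allFin-suc : map F (tabulate Fin.suc) ≡ map (λ r → F (Fin.suc r)) (allFin n)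
  allFin-suc = trans (ListP.map-tabulate Fin.suc F) (sym (ListP.map-tabulate (λ r → r) (λ r → F (Fin.suc r))))
  split : ∀ k → (∀ r → ¬ r ≡ k → F r ≡ 0ℤ) → F Fin.zero + Σℤ (map (λ r → F (Fin.suc r)) (allFin n)) ≡ F k
  split Fin.zero    F≡0 = trans (cong (_+_ (F Fin.zero)) (Σℤ-map-zero (allFin n) _ (λ r → F≡0 (Fin.suc r) (λ ())))) (ℤP.+-identityʳ _)
  split (Fin.suc k) F≡0 = trans (cong₂ _+_ (F≡0 Fin.zero (λ ()))
                                          (Σℤ-allFin-single n (λ r → F (Fin.suc r)) k (λ r r≢k → F≡0 (Fin.suc r) (λ e → r≢k (suc-injective e)))))
                                (ℤP.+-identityˡ _)

infix 9 Σ[1‥_]_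

Σ[1‥_]_ : ℕ → (ℕ → ℤ) → ℤ
Σ[1‥ zero  ] f = 0ℤ
Σ[1‥ suc k ] f = Σ[1‥ k ] f + f (suc k)

Σℤ-[1‥] : ∀ (f : ℕ → ℤ) k → Σℤ (map f [1‥ k ]) ≡ Σ[1‥ k ] f
Σℤ-[1‥] f zero    = refl
Σℤ-[1‥] f (suc k) = begin
  Σℤ (map f (map suc (upTo (suc k))))            ≡⟨ cong (λ xs → Σℤ (map f (map suc xs))) (sym (ListP.upTo-∷ʳ k)) ⟩
  Σℤ (map f (map suc (upTo k ++ k ∷ [])))        ≡⟨ cong (λ xs → Σℤ (map f xs)) (ListP.map-++ suc (upTo k) (k ∷ [])) ⟩
  Σℤ (map f (map suc (upTo k) ++ suc k ∷ []))    ≡⟨ cong Σℤ (ListP.map-++ f (map suc (upTo k)) (suc k ∷ [])) ⟩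
  Σℤ (map f [1‥ k ] ++ f (suc k) ∷ [])           ≡⟨ Σℤ-++ (map f [1‥ k ]) (f (suc k) ∷ []) ⟩
  Σℤ (map f [1‥ k ]) + (f (suc k) + 0ℤ)          ≡⟨ cong₂ _+_ (Σℤ-[1‥] f k) (ℤP.+-identityʳ _) ⟩
  Σ[1‥ k ] f + f (suc k)                          ∎
  where open ≡-Reasoning

Σ-cong : ∀ k {f g : ℕ → ℤ} → (∀ i → 1 ≤ i → i ≤ k → f i ≡ g i) → Σ[1‥ k ] f ≡ Σ[1‥ k ] g
Σ-cong zero    f≡g = refl
Σ-cong (suc k) f≡g = cong₂ _+_ (Σ-cong k (λ i 1≤i i≤k → f≡g i 1≤i (ℕP.m≤n⇒m≤1+n i≤k))) (f≡g (suc k) (s≤s z≤n) ℕP.≤-refl)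

Σ-zero : ∀ k (f : ℕ → ℤ) → (∀ i → 1 ≤ i → i ≤ k → f i ≡ 0ℤ) → Σ[1‥ k ] f ≡ 0ℤ
Σ-zero zero    f f≡0 = refl
Σ-zero (suc k) f f≡0 = trans (cong₂ _+_ (Σ-zero k f (λ i 1≤i i≤k → f≡0 i 1≤i (ℕP.m≤n⇒m≤1+n i≤k)))
                                      (f≡0 (suc k) (s≤s z≤n) ℕP.≤-refl))
                             (ℤP.+-identityˡ 0ℤ)

Σ-distrib-+ : ∀ k f g → Σ[1‥ k ] (λ i → f i + g i) ≡ Σ[1‥ k ] f + Σ[1‥ k ] g
Σ-distrib-+ zero    f g = refl
Σ-distrib-+ (suc k) f g =
  trans (cong (_+ (f (suc k) + g (suc k))) (Σ-distrib-+ k f g)) (+-interchange (Σ[1‥ k ] f) _ _ _)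

Σ-distrib-neg : ∀ k f → Σ[1‥ k ] (λ i → - f i) ≡ - Σ[1‥ k ] f
Σ-distrib-neg zero    f = refl
Σ-distrib-neg (suc k) f = trans (cong (_+ (- f (suc k))) (Σ-distrib-neg k f)) (sym (ℤP.neg-distrib-+ (Σ[1‥ k ] f) _))

Σ-*ˡ : ∀ k c f → Σ[1‥ k ] (λ i → c * f i) ≡ c * Σ[1‥ k ] f
Σ-*ˡ zero    c f = sym (ℤP.*-zeroʳ c)
Σ-*ˡ (suc k) c f = trans (cong (_+ c * f (suc k)) (Σ-*ˡ k c f)) (sym (ℤP.*-distribˡ-+ c (Σ[1‥ k ] f) _))

χ-Σ : ∀ b k f → χ b (Σ[1‥ k ] f) ≡ Σ[1‥ k ] (λ i → χ b (f i))
χ-Σ true  k f = refl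
χ-Σ false k f = sym (Σ-zero k _ (λ _ _ _ → refl))

Σ-+-range : ∀ j k f → Σ[1‥ j ℕ.+ k ] f ≡ Σ[1‥ j ] f + Σ[1‥ k ] (λ i → f (j ℕ.+ i))
Σ-+-range j zero    f = trans (cong (Σ[1‥_] f) (ℕP.+-identityʳ j)) (sym (ℤP.+-identityʳ _))
Σ-+-range j (suc k) f = begin
  Σ[1‥ j ℕ.+ suc k ] f
    ≡⟨ cong (Σ[1‥_] f) (ℕP.+-suc j k) ⟩
  Σ[1‥ j ℕ.+ k ] f + f (suc (j ℕ.+ k))
    ≡⟨ cong₂ _+_ (Σ-+-range j k f) (cong f (sym (ℕP.+-suc j k))) ⟩
  Σ[1‥ j ] f + Σ[1‥ k ] (λ i → f (j ℕ.+ i)) + f (j ℕ.+ suc k)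
    ≡⟨ ℤP.+-assoc (Σ[1‥ j ] f) _ _ ⟩
  Σ[1‥ j ] f + Σ[1‥ suc k ] (λ i → f (j ℕ.+ i)) ∎
  where open ≡-Reasoning

Σ-vanishing-tail : ∀ j k f → j ≤ k → (∀ i → j < i → f i ≡ 0ℤ) → Σ[1‥ k ] f ≡ Σ[1‥ j ] f
Σ-vanishing-tail j k f j≤k tail≡0 = begin
  Σ[1‥ k ] f
    ≡⟨ cong (Σ[1‥_] f) (sym (ℕP.m+[n∸m]≡n j≤k)) ⟩
  Σ[1‥ j ℕ.+ (k ℕ.∸ j) ] f
    ≡⟨ Σ-+-range j (k ℕ.∸ j) f ⟩
  Σ[1‥ j ] f + Σ[1‥ k ℕ.∸ j ] (λ i → f (j ℕ.+ i))
    ≡⟨ cong (_+_ (Σ[1‥ j ] f)) (Σ-zero (k ℕ.∸ j) _ (λ i 1≤i _ → tail≡0 (j ℕ.+ i) (ℕP.m<m+n j 1≤i))) ⟩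
  Σ[1‥ j ] f + 0ℤ
    ≡⟨ ℤP.+-identityʳ _ ⟩
  Σ[1‥ j ] f ∎
  where open ≡-Reasoning

Σ-single : ∀ k j f → 1 ≤ j → j ≤ k → (∀ i → 1 ≤ i → i ≤ k → ¬ i ≡ j → f i ≡ 0ℤ) → Σ[1‥ k ] f ≡ f j
Σ-single zero    .zero f () z≤n f≡0
Σ-single (suc k) j     f 1≤j j≤1+k f≡0 with j ℕ.≟ suc k
... | yes refl = trans (cong (_+ f (suc k)) (Σ-zero k f (λ i 1≤i i≤k → f≡0 i 1≤i (ℕP.m≤n⇒m≤1+n i≤k) (λ { refl → ℕP.1+n≰n i≤k }))))
                       (ℤP.+-identityˡ _)
... | no  j≢ = trans (cong₂ _+_ (Σ-single k j f 1≤j (ℕP.≤-pred (ℕP.≤∧≢⇒< j≤1+k j≢)) (λ i 1≤i i≤k → f≡0 i 1≤i (ℕP.m≤n⇒m≤1+n i≤k)))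
                                (f≡0 (suc k) (s≤s z≤n) ℕP.≤-refl (λ e → j≢ (sym e))))
                     (ℤP.+-identityʳ _)

Σ-comm : ∀ k l (f : ℕ → ℕ → ℤ) → Σ[1‥ k ] (λ i → Σ[1‥ l ] (f i)) ≡ Σ[1‥ l ] (λ j → Σ[1‥ k ] (λ i → f i j))
Σ-comm zero    l f = sym (Σ-zero l _ (λ _ _ _ → refl))
Σ-comm (suc k) l f = trans (cong (_+ Σ[1‥ l ] (f (suc k))) (Σ-comm k l f))
                           (sym (Σ-distrib-+ l (λ j → Σ[1‥ k ] (λ i → f i j)) (f (suc k))))

0≤Σ : ∀ k f → (∀ i → 0ℤ ℤ.≤ f i) → 0ℤ ℤ.≤ Σ[1‥ k ] f
0≤Σ zero    f 0≤f = ℤ.+≤+ z≤n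
0≤Σ (suc k) f 0≤f = ℤP.+-mono-≤ (0≤Σ k f 0≤f) (0≤f (suc k))

term≤Σ : ∀ k j f → (∀ i → 0ℤ ℤ.≤ f i) → 1 ≤ j → j ≤ k → f j ℤ.≤ Σ[1‥ k ] f
term≤Σ zero    j f 0≤f 1≤j j≤k = ⊥-elim (ℕP.1+n≰n (ℕP.≤-trans 1≤j j≤k))
term≤Σ (suc k) j f 0≤f 1≤j j≤1+k with j ℕ.≟ suc k
... | yes refl = ℤP.≤-trans (ℤP.≤-reflexive (sym (ℤP.+-identityˡ _))) (ℤP.+-monoˡ-≤ (f j) (0≤Σ k f 0≤f))
... | no  j≢ = ℤP.≤-trans (term≤Σ k j f 0≤f 1≤j (ℕP.≤-pred (ℕP.≤∧≢⇒< j≤1+k j≢)))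
                          (ℤP.≤-trans (ℤP.≤-reflexive (sym (ℤP.+-identityʳ _))) (ℤP.+-monoʳ-≤ (Σ[1‥ k ] f) (0≤f (suc k))))

Σ≢0⇒∃≢0 : ∀ k f → ¬ Σ[1‥ k ] f ≡ 0ℤ → ∃ λ j → 1 ≤ j × j ≤ k × ¬ f j ≡ 0ℤ
Σ≢0⇒∃≢0 zero    f Σ≢0 = ⊥-elim (Σ≢0 refl)
Σ≢0⇒∃≢0 (suc k) f Σ≢0 with f (suc k) ℤ.≟ 0ℤ
... | no  f≢0 = suc k , s≤s z≤n , ℕP.≤-refl , f≢0
... | yes f≡0 with Σ≢0⇒∃≢0 k f (λ Σ≡0 → Σ≢0 (cong₂ _+_ Σ≡0 f≡0))
...   | j , 1≤j , j≤k , fj≢0 = j , 1≤j , ℕP.m≤n⇒m≤1+n j≤k , fj≢0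

length-filter-[1‥] : ∀ {P : Pred ℕ 0ℓ} (P? : Decidable P) k →
  + length (filter P? [1‥ k ]) ≡ Σ[1‥ k ] (λ i → χ (does (P? i)) 1ℤ)
length-filter-[1‥] P? k = begin
  + length (filter P? [1‥ k ])                  ≡⟨ sym (Σℤ-map-const1 (filter P? [1‥ k ])) ⟩
  Σℤ (map (λ _ → 1ℤ) (filter P? [1‥ k ]))       ≡⟨ Σℤ-map-filter P? (λ _ → 1ℤ) [1‥ k ] ⟩
  Σℤ (map (λ i → χ (does (P? i)) 1ℤ) [1‥ k ])   ≡⟨ Σℤ-[1‥] _ k ⟩
  Σ[1‥ k ] (λ i → χ (does (P? i)) 1ℤ)           ∎
  where open ≡-Reasoning

Σ-multiples : ∀ p k f → 1 ≤ p → (∀ i → ¬ p ∣ i → f i ≡ 0ℤ) → Σ[1‥ k ℕ.* p ] f ≡ Σ[1‥ k ] (λ d → f (d ℕ.* p))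
Σ-multiples p zero    f 1≤p f≡0 = refl
Σ-multiples p (suc k) f 1≤p f≡0 = begin
  Σ[1‥ p ℕ.+ k ℕ.* p ] f
    ≡⟨ cong (Σ[1‥_] f) (ℕP.+-comm p (k ℕ.* p)) ⟩
  Σ[1‥ k ℕ.* p ℕ.+ p ] f
    ≡⟨ Σ-+-range (k ℕ.* p) p f ⟩
  Σ[1‥ k ℕ.* p ] f + Σ[1‥ p ] (λ j → f (k ℕ.* p ℕ.+ j))
    ≡⟨ cong₂ _+_ (Σ-multiples p k f 1≤p f≡0) (Σ-single p p _ 1≤p ℕP.≤-refl (λ j 1≤j j≤p j≢p → f≡0 _ (p∤kp+j j 1≤j j≤p j≢p))) ⟩
  Σ[1‥ k ] (λ d → f (d ℕ.* p)) + f (k ℕ.* p ℕ.+ p)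
    ≡⟨ cong (λ i → Σ[1‥ k ] (λ d → f (d ℕ.* p)) + f i) (ℕP.+-comm (k ℕ.* p) p) ⟩
  Σ[1‥ k ] (λ d → f (d ℕ.* p)) + f (p ℕ.+ k ℕ.* p) ∎
  where
  open ≡-Reasoning
  p∤kp+j : ∀ j → 1 ≤ j → j ≤ p → ¬ j ≡ p → ¬ p ∣ k ℕ.* p ℕ.+ j
  p∤kp+j j 1≤j j≤p j≢p p∣ = j≢p (ℕP.≤-antisym j≤p (∣⇒≤ {{ℕ.>-nonZero 1≤j}} (∣m+n∣m⇒∣n p∣ (n∣m*n k))))

-- The Möbius function

SquareFree : ℕ → Set
SquareFree d = ∀ k → 2 ≤ k → ¬ (k ℕ.* k ∣ d)

primeCount : ℕ → ℕ
primeCount d = length (filter (primeDivides? d) [1‥ d ])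

n≤n*n : ∀ n → 1 ≤ n → n ≤ n ℕ.* n
n≤n*n (suc n) _ = ℕP.m≤m+n (suc n) (n ℕ.* suc n)

square≤ : ∀ {d k} → 1 ≤ d → 2 ≤ k → k ℕ.* k ∣ d → k ≤ d
square≤ 1≤d 2≤k kk∣d = ℕP.≤-trans (n≤n*n _ (ℕP.<⇒≤ 2≤k)) (∣⇒≤ {{ℕ.>-nonZero 1≤d}} kk∣d)

squareDivides-counts : ∀ {d k} → 1 ≤ d → 2 ≤ k → k ℕ.* k ∣ d → 1ℤ ℤ.≤ + length (filter (squareDivides? d) [1‥ d ])
squareDivides-counts {d} {k} 1≤d 2≤k kk∣d = begin
  1ℤ
    ≡⟨ sym (χ-dec-true (squareDivides? d k) (2≤k , kk∣d)) ⟩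
  χ (does (squareDivides? d k)) 1ℤ
    ≤⟨ term≤Σ d k _ (λ i → 0≤χ1 _) (ℕP.<⇒≤ 2≤k) (square≤ 1≤d 2≤k kk∣d) ⟩
  Σ[1‥ d ] (λ i → χ (does (squareDivides? d i)) 1ℤ)
    ≡⟨ sym (length-filter-[1‥] (squareDivides? d) d) ⟩
  + length (filter (squareDivides? d) [1‥ d ]) ∎
  where open ℤP.≤-Reasoning

μ-squareful : ∀ {d k} → 1 ≤ d → 2 ≤ k → k ℕ.* k ∣ d → μ d ≡ 0ℤ
μ-squareful {d} 1≤d 2≤k kk∣d with length (filter (squareDivides? d) [1‥ d ]) | squareDivides-counts 1≤d 2≤k kk∣d
... | suc _ | _           = refl
... | zero  | ℤ.+≤+ ()

μ-squareFree : ∀ {d} → SquareFree d → μ d ≡ -1ℤ ^ primeCount d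
μ-squareFree {d} sf with length (filter (squareDivides? d) [1‥ d ]) | cong length noSquares
  where
  noSquares : filter (squareDivides? d) [1‥ d ] ≡ []
  noSquares = ListP.filter-none (squareDivides? d) (All.universal (λ k (2≤k , kk∣d) → sf k 2≤k kk∣d) [1‥ d ])
... | zero  | _  = refl
... | suc _ | ()

squareFree⊎squareful : ∀ d → 1 ≤ d → SquareFree d ⊎ ∃ λ k → 2 ≤ k × k ℕ.* k ∣ d
squareFree⊎squareful d 1≤d with Σ[1‥ d ] (λ i → χ (does (squareDivides? d i)) 1ℤ) ℤ.≟ 0ℤ
... | yes Σ≡0 = inj₁ λ k 2≤k kk∣d → ℤP.<-irrefl refl (ℤP.<-≤-trans (ℤ.+<+ (s≤s z≤n))
                   (ℤP.≤-trans (squareDivides-counts 1≤d 2≤k kk∣d)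
                     (ℤP.≤-reflexive (trans (length-filter-[1‥] (squareDivides? d) d) Σ≡0))))
... | no  Σ≢0 with Σ≢0⇒∃≢0 d _ Σ≢0
...   | k , _ , _ , χ≢0 = inj₂ (k , χ≢0⇒holds (squareDivides? d k) χ≢0)

prime∤⇒coprime : ∀ {p d} → Prime p → ¬ p ∣ d → Coprime d p
prime∤⇒coprime pp p∤d (i∣d , i∣p) with prime⇒irreducible pp i∣p
... | inj₁ i≡1 = i≡1
... | inj₂ refl = ⊥-elim (p∤d i∣d)

squareFree-*prime : ∀ {p d} → Prime p → ¬ p ∣ d → SquareFree d → SquareFree (p ℕ.* d)
squareFree-*prime {p} {d} pp p∤d sf k 2≤k kk∣pd with p ∣? k
... | no p∤k = sf k 2≤k (coprime-divisor (prime∤⇒coprime pp p∤kk) kk∣pd)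
  where
  p∤kk : ¬ p ∣ k ℕ.* k
  p∤kk p∣kk with euclidsLemma k k pp p∣kk
  ... | inj₁ p∣k = p∤k p∣k
  ... | inj₂ p∣k = p∤k p∣k
... | yes (divides q refl) = p∤d (∣-trans (divides (q ℕ.* q) (ℕP.*-comm p (q ℕ.* q)))
                                          (*-cancelˡ-∣ p {{prime⇒nonZero pp}} (subst (_∣ p ℕ.* d) (regroup q p) kk∣pd)))
  where
  regroup : ∀ q p → (q ℕ.* p) ℕ.* (q ℕ.* p) ≡ p ℕ.* (p ℕ.* (q ℕ.* q))
  regroup = solve-∀ℕ

primeDivides-*prime : ∀ {p d} → Prime p → ¬ p ∣ d → ∀ q →
  χ (does (primeDivides? (p ℕ.* d) q)) 1ℤ ≡ χ (does (q ℕ.≟ p)) 1ℤ + χ (does (primeDivides? d q)) 1ℤ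
primeDivides-*prime {p} {d} pp p∤d q with q ℕ.≟ p
... | yes refl = trans (χ-dec-true (primeDivides? (p ℕ.* d) p) (pp , m∣m*n d))
                       (sym (cong₂ _+_ (χ-dec-true (p ℕ.≟ p) refl) (χ-dec-false (primeDivides? d p) (λ (_ , p∣d) → p∤d p∣d))))
... | no  q≢p = begin
  χ (does (primeDivides? (p ℕ.* d) q)) 1ℤ
    ≡⟨ cong (λ b → χ b 1ℤ) (does-⇔ (mk⇔ to from) (primeDivides? (p ℕ.* d) q) (primeDivides? d q)) ⟩
  χ (does (primeDivides? d q)) 1ℤ
    ≡⟨ sym (ℤP.+-identityˡ _) ⟩
  0ℤ + χ (does (primeDivides? d q)) 1ℤ
    ≡⟨ cong (_+ χ (does (primeDivides? d q)) 1ℤ) (sym (χ-dec-false (q ℕ.≟ p) q≢p)) ⟩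
  χ (does (q ℕ.≟ p)) 1ℤ + χ (does (primeDivides? d q)) 1ℤ ∎
  where
  open ≡-Reasoning
  to : Prime q × q ∣ p ℕ.* d → Prime q × q ∣ d
  to (pq , q∣pd) with euclidsLemma p d pq q∣pd
  ... | inj₂ q∣d = pq , q∣d
  ... | inj₁ q∣p with prime⇒irreducible pp q∣p
  ...   | inj₁ refl = ⊥-elim (¬prime[1] pq)
  ...   | inj₂ q≡p  = ⊥-elim (q≢p q≡p)
  from : Prime q × q ∣ d → Prime q × q ∣ p ℕ.* d
  from (pq , q∣d) = pq , ∣n⇒∣m*n p q∣d

primeCount-*prime : ∀ {p d} → Prime p → ¬ p ∣ d → 1 ≤ d → primeCount (p ℕ.* d) ≡ suc (primeCount d)
primeCount-*prime {p} {d} pp p∤d 1≤d = ℤP.+-injective (begin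
  + primeCount (p ℕ.* d)
    ≡⟨ length-filter-[1‥] _ (p ℕ.* d) ⟩
  Σ[1‥ p ℕ.* d ] (λ q → χ (does (primeDivides? (p ℕ.* d) q)) 1ℤ)
    ≡⟨ Σ-cong (p ℕ.* d) (λ q _ _ → primeDivides-*prime pp p∤d q) ⟩
  Σ[1‥ p ℕ.* d ] (λ q → χ (does (q ℕ.≟ p)) 1ℤ + χ (does (primeDivides? d q)) 1ℤ)
    ≡⟨ Σ-distrib-+ (p ℕ.* d) _ _ ⟩
  Σ[1‥ p ℕ.* d ] (λ q → χ (does (q ℕ.≟ p)) 1ℤ) + Σ[1‥ p ℕ.* d ] (λ q → χ (does (primeDivides? d q)) 1ℤ)
    ≡⟨ cong₂ _+_ (trans (Σ-single (p ℕ.* d) p _ 1≤p p≤pd (λ q _ _ q≢p → χ-dec-false (q ℕ.≟ p) q≢p)) (χ-dec-true (p ℕ.≟ p) refl))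
                 (Σ-vanishing-tail d (p ℕ.* d) _ (ℕP.m≤n*m d p {{prime⇒nonZero pp}})
                    (λ q d<q → χ-dec-false (primeDivides? d q) (λ (_ , q∣d) → ℕP.<⇒≱ d<q (∣⇒≤ {{ℕ.>-nonZero 1≤d}} q∣d)))) ⟩
  1ℤ + Σ[1‥ d ] (λ q → χ (does (primeDivides? d q)) 1ℤ)
    ≡⟨ cong (_+_ 1ℤ) (sym (length-filter-[1‥] _ d)) ⟩
  1ℤ + + primeCount d
    ≡⟨ sym (ℤP.pos-+ 1 _) ⟩
  + suc (primeCount d) ∎)
  where
  open ≡-Reasoning
  1≤p : 1 ≤ p
  1≤p = ℕP.<⇒≤ (ℕ.nonTrivial⇒n>1 p {{prime⇒nonTrivial pp}})
  p≤pd : p ≤ p ℕ.* d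
  p≤pd = ℕP.m≤m*n p d {{ℕ.>-nonZero 1≤d}}

μ-*prime : ∀ {p d} → Prime p → ¬ p ∣ d → 1 ≤ d → μ (p ℕ.* d) ≡ - μ d
μ-*prime {p} {d} pp p∤d 1≤d with squareFree⊎squareful d 1≤d
... | inj₂ (k , 2≤k , kk∣d) = trans (μ-squareful 1≤pd 2≤k (∣n⇒∣m*n p kk∣d)) (sym (cong -_ (μ-squareful 1≤d 2≤k kk∣d)))
  where
  1≤pd : 1 ≤ p ℕ.* d
  1≤pd = ℕP.≤-trans 1≤d (ℕP.m≤n*m d p {{prime⇒nonZero pp}})
... | inj₁ sf = begin
  μ (p ℕ.* d)                          ≡⟨ μ-squareFree (squareFree-*prime pp p∤d sf) ⟩
  -1ℤ ^ primeCount (p ℕ.* d)           ≡⟨ cong (-1ℤ ^_) (primeCount-*prime pp p∤d 1≤d) ⟩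
  -1ℤ * -1ℤ ^ primeCount d             ≡⟨ ℤP.-1*i≡-i _ ⟩
  - (-1ℤ ^ primeCount d)               ≡⟨ cong -_ (sym (μ-squareFree sf)) ⟩
  - μ d                                ∎
  where open ≡-Reasoning

μ-*prime² : ∀ {p d} → Prime p → 1 ≤ d → μ (p ℕ.* (p ℕ.* d)) ≡ 0ℤ
μ-*prime² {p} {d} pp 1≤d = μ-squareful (ℕP.≤-trans 1≤d (ℕP.≤-trans (ℕP.m≤n*m d p) (ℕP.m≤n*m (p ℕ.* d) p)))
                                        (ℕ.nonTrivial⇒n>1 p {{prime⇒nonTrivial pp}})
                                        (subst (p ℕ.* p ∣_) (ℕP.*-assoc p p d) (m∣m*n d))
  where
  instance
    p≢0 : NonZero p
    p≢0 = prime⇒nonZero pp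

1≤m*n⇒1≤m : ∀ m {n} → 1 ≤ m ℕ.* n → 1 ≤ m
1≤m*n⇒1≤m (suc m) _ = s≤s z≤n

∃prime∣ : ∀ M → 1 < M → ∃ λ p → Prime p × p ∣ M
∃prime∣ M 1<M with factorise M {{ℕ.>-nonZero (ℕP.<-trans (s≤s z≤n) 1<M)}}
... | record { factors = [] ; isFactorisation = M≡1 } = ⊥-elim (ℕP.<-irrefl (sym M≡1) 1<M)
... | record { factors = p ∷ _ ; isFactorisation = M≡p*_ ; factorsPrime = pp All.∷ _ } = p , pp , subst (p ∣_) (sym M≡p*_) (m∣m*n _)

module _ {p K : ℕ} (pp : Prime p) where

  private instance
    p≢0 : NonZero p
    p≢0 = prime⇒nonZero pp

  χμ-*prime : ∀ d → 1 ≤ d →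
    χ (does (d ℕ.* p ∣? K ℕ.* p)) (μ (d ℕ.* p)) ≡ χ (does (d ∣? K)) (χ (does (¬? (p ∣? d))) (- μ d))
  χμ-*prime d 1≤d = begin
    χ (does (d ℕ.* p ∣? K ℕ.* p)) (μ (d ℕ.* p))
      ≡⟨ cong (λ b → χ b (μ (d ℕ.* p))) (does-⇔ (mk⇔ (*-cancelʳ-∣ p) (*-monoˡ-∣ p)) (d ℕ.* p ∣? K ℕ.* p) (d ∣? K)) ⟩
    χ (does (d ∣? K)) (μ (d ℕ.* p))
      ≡⟨ cong (χ (does (d ∣? K))) (μdp (p ∣? d)) ⟩
    χ (does (d ∣? K)) (χ (does (¬? (p ∣? d))) (- μ d)) ∎
    where
    open ≡-Reasoning
    μdp : (p∣?d : Dec (p ∣ d)) → μ (d ℕ.* p) ≡ χ (does (¬? p∣?d)) (- μ d)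
    μdp (yes (divides q refl)) = trans (cong μ (regroup q p)) (μ-*prime² pp (1≤m*n⇒1≤m q 1≤d))
      where
      regroup : ∀ q p → (q ℕ.* p) ℕ.* p ≡ p ℕ.* (p ℕ.* q)
      regroup = solve-∀ℕ
    μdp (no p∤d) = trans (cong μ (ℕP.*-comm d p)) (μ-*prime pp p∤d 1≤d)

  χ∣-*prime-coprime : ∀ d v → χ (does (¬? (p ∣? d))) (χ (does (d ∣? K ℕ.* p)) v) ≡ χ (does (¬? (p ∣? d))) (χ (does (d ∣? K)) v)
  χ∣-*prime-coprime d v with p ∣? d
  ... | yes _   = refl
  ... | no  p∤d = cong (λ b → χ b v) (does-⇔ (mk⇔ to (∣m⇒∣m*n p)) (d ∣? K ℕ.* p) (d ∣? K))
    where
    to : d ∣ K ℕ.* p → d ∣ K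
    to d∣Kp = coprime-divisor (prime∤⇒coprime pp p∤d) (subst (d ∣_) (ℕP.*-comm K p) d∣Kp)

  Σμ-divisors-of-multiple : ∀ {L} → 1 ≤ K → K ℕ.* p ≤ L → Σ[1‥ L ] (λ d → χ (does (d ∣? K ℕ.* p)) (μ d)) ≡ 0ℤ
  Σμ-divisors-of-multiple {L} 1≤K M≤L = begin
    Σ[1‥ L ] g
      ≡⟨ Σ-vanishing-tail M L g M≤L (λ d M<d → χ-dec-false (d ∣? M) (λ d∣M → ℕP.<⇒≱ M<d (∣⇒≤ {{ℕ.>-nonZero 1≤M}} d∣M))) ⟩
    Σ[1‥ M ] g
      ≡⟨ Σ-cong M (λ d _ _ → χ-split (does (p ∣? d)) (g d)) ⟩
    Σ[1‥ M ] (λ d → χ (does (p ∣? d)) (g d) + χ (does (¬? (p ∣? d))) (g d))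
      ≡⟨ Σ-distrib-+ M _ _ ⟩
    Σ[1‥ M ] (λ d → χ (does (p ∣? d)) (g d)) + Σ[1‥ M ] (λ d → χ (does (¬? (p ∣? d))) (g d))
      ≡⟨ cong₂ _+_ (trans (Σ-multiples p K _ 1≤p (λ i p∤i → χ-dec-false (p ∣? i) p∤i)) (Σ-cong K (λ d 1≤d _ → multiple d 1≤d)))
                   (trans (Σ-cong M (λ d _ _ → trans (χ∣-*prime-coprime d (μ d)) (χ-comm (does (¬? (p ∣? d))) (does (d ∣? K)) (μ d))))
                          (Σ-vanishing-tail K M _ (ℕP.m≤m*n K p)
                             (λ d K<d → χ-dec-false (d ∣? K) (λ d∣K → ℕP.<⇒≱ K<d (∣⇒≤ {{ℕ.>-nonZero 1≤K}} d∣K))))) ⟩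
    Σ[1‥ K ] (λ d → h d (- μ d)) + Σ[1‥ K ] (λ d → h d (μ d))
      ≡⟨ sym (Σ-distrib-+ K _ _) ⟩
    Σ[1‥ K ] (λ d → h d (- μ d) + h d (μ d))
      ≡⟨ Σ-zero K _ (λ d _ _ → cancel d) ⟩
    0ℤ ∎
    where
    open ≡-Reasoning
    M : ℕ
    M = K ℕ.* p
    g : ℕ → ℤ
    g d = χ (does (d ∣? M)) (μ d)
    h : ℕ → ℤ → ℤ
    h d v = χ (does (d ∣? K)) (χ (does (¬? (p ∣? d))) v)
    1≤p : 1 ≤ p
    1≤p = ℕP.<⇒≤ (ℕ.nonTrivial⇒n>1 p {{prime⇒nonTrivial pp}})
    1≤M : 1 ≤ M
    1≤M = ℕP.≤-trans 1≤K (ℕP.m≤m*n K p)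
    multiple : ∀ d → 1 ≤ d → χ (does (p ∣? d ℕ.* p)) (g (d ℕ.* p)) ≡ h d (- μ d)
    multiple d 1≤d = trans (χ-dec-true (p ∣? d ℕ.* p) (n∣m*n d)) (χμ-*prime d 1≤d)
    cancel : ∀ d → h d (- μ d) + h d (μ d) ≡ 0ℤ
    cancel d = begin
      h d (- μ d) + h d (μ d)
        ≡⟨ sym (χ-distrib-+ (does (d ∣? K)) _ _) ⟩
      χ (does (d ∣? K)) (χ (does (¬? (p ∣? d))) (- μ d) + χ (does (¬? (p ∣? d))) (μ d))
        ≡⟨ cong (χ (does (d ∣? K))) (χ-inverseˡ (does (¬? (p ∣? d))) (μ d)) ⟩
      χ (does (d ∣? K)) 0ℤ
        ≡⟨ χ-zero _ ⟩
      0ℤ ∎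

Σμ-divisors : ∀ M L → 1 ≤ M → M ≤ L → Σ[1‥ L ] (λ d → χ (does (d ∣? M)) (μ d)) ≡ χ (does (M ℕ.≟ 1)) 1ℤ
Σμ-divisors 1 L _ 1≤L = Σ-single L 1 _ (s≤s z≤n) 1≤L (λ d _ _ d≢1 → χ-dec-false (d ∣? 1) (λ d∣1 → d≢1 (∣1⇒≡1 d∣1)))
Σμ-divisors M@(suc (suc _)) L _ M≤L with ∃prime∣ M (s≤s (s≤s z≤n))
... | p , pp , divides K M≡Kp = subst (λ M → Σ[1‥ L ] (λ d → χ (does (d ∣? M)) (μ d)) ≡ 0ℤ) (sym M≡Kp)
                                      (Σμ-divisors-of-multiple pp (1≤m*n⇒1≤m K (subst (1 ≤_) M≡Kp (s≤s z≤n))) (subst (_≤ L) M≡Kp M≤L))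

Σμ-multiples : ∀ e M L → 1 ≤ e → 1 ≤ M → M ≤ L → Σ[1‥ L ] (λ f → χ (does (f ℕ.* e ∣? M)) (μ f)) ≡ χ (does (e ℕ.≟ M)) 1ℤ
Σμ-multiples e M L 1≤e 1≤M M≤L with e ∣? M
... | no e∤M = trans (Σ-zero L _ (λ f _ _ → χ-dec-false (f ℕ.* e ∣? M) (λ fe∣M → e∤M (∣-trans (n∣m*n f) fe∣M))))
                     (sym (χ-dec-false (e ℕ.≟ M) (λ { refl → e∤M ∣-refl })))
... | yes (divides M′ refl) = begin
  Σ[1‥ L ] (λ f → χ (does (f ℕ.* e ∣? M′ ℕ.* e)) (μ f))
    ≡⟨ Σ-cong L (λ f _ _ → cong (λ b → χ b (μ f)) (does-⇔ (mk⇔ (*-cancelʳ-∣ e) (*-monoˡ-∣ e)) (f ℕ.* e ∣? M′ ℕ.* e) (f ∣? M′))) ⟩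
  Σ[1‥ L ] (λ f → χ (does (f ∣? M′)) (μ f))
    ≡⟨ Σμ-divisors M′ L 1≤M′ (ℕP.≤-trans (ℕP.m≤m*n M′ e) M≤L) ⟩
  χ (does (M′ ℕ.≟ 1)) 1ℤ
    ≡⟨ cong (λ b → χ b 1ℤ) (does-⇔ (mk⇔ to from) (M′ ℕ.≟ 1) (e ℕ.≟ M′ ℕ.* e)) ⟩
  χ (does (e ℕ.≟ M′ ℕ.* e)) 1ℤ ∎
  where
  open ≡-Reasoning
  instance
    e≢0 : NonZero e
    e≢0 = ℕ.>-nonZero 1≤e
  1≤M′ : 1 ≤ M′
  1≤M′ = 1≤m*n⇒1≤m M′ 1≤M
  to : M′ ≡ 1 → e ≡ M′ ℕ.* e
  to refl = sym (ℕP.*-identityˡ e)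
  from : e ≡ M′ ℕ.* e → M′ ≡ 1
  from e≡M′e = ℕP.*-cancelʳ-≡ M′ 1 e (trans (sym e≡M′e) (sym (ℕP.*-identityˡ e)))

ξμ-term : ℕ → ℕ → ℕ → ℕ → ℤ
ξμ-term a d e f = χ (does (e ℕ.* f ℕ.≟ d)) (+ (e ℕ.^ a) * μ f)

ξμ-term-large : ∀ a d e f → d < e ℕ.* f → ξμ-term a d e f ≡ 0ℤ
ξμ-term-large a d e f d<ef = χ-dec-false (e ℕ.* f ℕ.≟ d) (λ ef≡d → ℕP.<-irrefl (sym ef≡d) d<ef)

ξ*μ≡Σξμ-term : ∀ a d K → 1 ≤ d → d ≤ K → ξ*μ a d ≡ Σ[1‥ K ] (λ e → Σ[1‥ K ] (ξμ-term a d e))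
ξ*μ≡Σξμ-term a d K 1≤d d≤K = begin
  ξ*μ a d
    ≡⟨ Σℤ-map-filter (λ ef → proj₁ ef ℕ.* proj₂ ef ℕ.≟ d) (λ ef → + (proj₁ ef ℕ.^ a) * μ (proj₂ ef)) (cartesianProduct [1‥ d ] [1‥ d ]) ⟩
  Σℤ (map (λ ef → ξμ-term a d (proj₁ ef) (proj₂ ef)) (cartesianProduct [1‥ d ] [1‥ d ]))
    ≡⟨ Σℤ-cartesianProduct _ [1‥ d ] [1‥ d ] ⟩
  Σℤ (map (λ e → Σℤ (map (ξμ-term a d e) [1‥ d ])) [1‥ d ])
    ≡⟨ trans (cong Σℤ (ListP.map-cong (λ e → Σℤ-[1‥] (ξμ-term a d e) d) [1‥ d ])) (Σℤ-[1‥] _ d) ⟩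
  Σ[1‥ d ] (λ e → Σ[1‥ d ] (ξμ-term a d e))
    ≡⟨ Σ-cong d (λ e 1≤e _ → sym (Σ-vanishing-tail d K _ d≤K
         (λ f d<f → ξμ-term-large a d e f (ℕP.<-≤-trans d<f (ℕP.m≤n*m f e {{ℕ.>-nonZero 1≤e}}))))) ⟩
  Σ[1‥ d ] (λ e → Σ[1‥ K ] (ξμ-term a d e))
    ≡⟨ sym (Σ-vanishing-tail d K _ d≤K
         (λ e d<e → Σ-zero K _ (λ f 1≤f _ → ξμ-term-large a d e f (ℕP.<-≤-trans d<e (ℕP.m≤m*n e f {{ℕ.>-nonZero 1≤f}}))))) ⟩
  Σ[1‥ K ] (λ e → Σ[1‥ K ] (ξμ-term a d e))
    ∎
  where open ≡-Reasoning

Σ-divisors-ξμ-term : ∀ a M K e f → 1 ≤ e → 1 ≤ f → 1 ≤ M → M ≤ K →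
  Σ[1‥ K ] (λ d → χ (does (d ∣? M)) (ξμ-term a d e f)) ≡ χ (does (f ℕ.* e ∣? M)) (+ (e ℕ.^ a) * μ f)
Σ-divisors-ξμ-term a M K e f 1≤e 1≤f 1≤M M≤K with e ℕ.* f ℕ.≤? K
... | yes ef≤K = begin
  Σ[1‥ K ] (λ d → χ (does (d ∣? M)) (ξμ-term a d e f))
    ≡⟨ Σ-single K (e ℕ.* f) _ (ℕP.*-mono-≤ 1≤e 1≤f) ef≤K
         (λ d _ _ d≢ef → trans (cong (χ (does (d ∣? M))) (χ-dec-false (e ℕ.* f ℕ.≟ d) (λ ef≡d → d≢ef (sym ef≡d))))
                               (χ-zero (does (d ∣? M)))) ⟩
  χ (does (e ℕ.* f ∣? M)) (ξμ-term a (e ℕ.* f) e f)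
    ≡⟨ cong₂ χ (does-⇔ (mk⇔ (subst (_∣ M) (ℕP.*-comm e f)) (subst (_∣ M) (ℕP.*-comm f e))) (e ℕ.* f ∣? M) (f ℕ.* e ∣? M))
               (χ-dec-true (e ℕ.* f ℕ.≟ e ℕ.* f) refl) ⟩
  χ (does (f ℕ.* e ∣? M)) (+ (e ℕ.^ a) * μ f)
    ∎
  where open ≡-Reasoning
... | no ef≰K = trans (Σ-zero K _ (λ d _ d≤K → trans (cong (χ (does (d ∣? M))) (ξμ-term-large a d e f (ℕP.≤-<-trans d≤K (ℕP.≰⇒> ef≰K))))
                                                  (χ-zero (does (d ∣? M)))))
                      (sym (χ-dec-false (f ℕ.* e ∣? M) (λ fe∣M → ef≰K (subst (_≤ K) (ℕP.*-comm f e) (ℕP.≤-trans (∣⇒≤ {{ℕ.>-nonZero 1≤M}} fe∣M) M≤K)))))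

Σ-divisors-ξ*μ : ∀ a M K → 1 ≤ M → M ≤ K → Σ[1‥ K ] (λ d → χ (does (d ∣? M)) (ξ*μ a d)) ≡ + (M ℕ.^ a)
Σ-divisors-ξ*μ a M K 1≤M M≤K = begin
  Σ[1‥ K ] (λ d → χ (does (d ∣? M)) (ξ*μ a d))
    ≡⟨ Σ-cong K (λ d 1≤d d≤K → trans (cong (χ (does (d ∣? M))) (ξ*μ≡Σξμ-term a d K 1≤d d≤K))
                                     (trans (χ-Σ (does (d ∣? M)) K _) (Σ-cong K (λ e _ _ → χ-Σ (does (d ∣? M)) K _)))) ⟩
  Σ[1‥ K ] (λ d → Σ[1‥ K ] (λ e → Σ[1‥ K ] (λ f → χ (does (d ∣? M)) (ξμ-term a d e f))))
    ≡⟨ trans (Σ-comm K K _) (Σ-cong K (λ e _ _ → Σ-comm K K _)) ⟩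
  Σ[1‥ K ] (λ e → Σ[1‥ K ] (λ f → Σ[1‥ K ] (λ d → χ (does (d ∣? M)) (ξμ-term a d e f))))
    ≡⟨ Σ-cong K (λ e 1≤e _ → Σ-cong K (λ f 1≤f _ → trans (Σ-divisors-ξμ-term a M K e f 1≤e 1≤f 1≤M M≤K)
                                                           (χ-*ˡ (does (f ℕ.* e ∣? M)) (+ (e ℕ.^ a)) (μ f)))) ⟩
  Σ[1‥ K ] (λ e → Σ[1‥ K ] (λ f → + (e ℕ.^ a) * χ (does (f ℕ.* e ∣? M)) (μ f)))
    ≡⟨ Σ-cong K (λ e 1≤e _ → trans (Σ-*ˡ K (+ (e ℕ.^ a)) _) (cong (+ (e ℕ.^ a) *_) (Σμ-multiples e M K 1≤e 1≤M M≤K))) ⟩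
  Σ[1‥ K ] (λ e → + (e ℕ.^ a) * χ (does (e ℕ.≟ M)) 1ℤ)
    ≡⟨ Σ-single K M _ 1≤M M≤K (λ e _ _ e≢M → trans (cong (+ (e ℕ.^ a) *_) (χ-dec-false (e ℕ.≟ M) e≢M)) (ℤP.*-zeroʳ (+ (e ℕ.^ a)))) ⟩
  + (M ℕ.^ a) * χ (does (M ℕ.≟ M)) 1ℤ
    ≡⟨ trans (cong (+ (M ℕ.^ a) *_) (χ-dec-true (M ℕ.≟ M) refl)) (ℤP.*-identityʳ _) ⟩
  + (M ℕ.^ a)
    ∎
  where open ≡-Reasoning

-- Gcd and lcm

m∣n⇒gcd[m,n]≡m : ∀ {m n} → m ∣ n → gcd m n ≡ m
m∣n⇒gcd[m,n]≡m {m} {n} m∣n = ∣-antisym (gcd[m,n]∣m m n) (gcd-greatest ∣-refl m∣n)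

m∣n⇒lcm[m,n]≡n : ∀ {m n} → m ∣ n → lcm m n ≡ n
m∣n⇒lcm[m,n]≡n {m} {n} m∣n = ∣-antisym (lcm-least m∣n ∣-refl) (n∣lcm[m,n] m n)

lcm-absorb : ∀ {u L X Y} → u ∣ L → X ∣ Y → lcm u X ≡ Y → lcm L X ≡ lcm L Y
lcm-absorb {u} {L} {X} {Y} u∣L X∣Y lcm[u,X]≡Y = ∣-antisym
  (lcm-least (m∣lcm[m,n] L Y) (∣-trans X∣Y (n∣lcm[m,n] L Y)))
  (lcm-least (m∣lcm[m,n] L X) (subst (_∣ lcm L X) lcm[u,X]≡Y (lcm-least (∣-trans u∣L (m∣lcm[m,n] L X)) (n∣lcm[m,n] L X))))

lcm-scale : ∀ {L X Y A} → 1 ≤ L → gcd L Y ≡ gcd L X → Y ≡ A ℕ.* X → lcm L Y ≡ A ℕ.* lcm L X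
lcm-scale {L} {X} {Y} {A} 1≤L gcd≡ Y≡AX = ℕP.*-cancelˡ-≡ (lcm L Y) (A ℕ.* lcm L X) (gcd L X) {{gcd≢0}} (begin
  gcd L X ℕ.* lcm L Y            ≡⟨ cong (ℕ._* lcm L Y) (sym gcd≡) ⟩
  gcd L Y ℕ.* lcm L Y            ≡⟨ gcd*lcm L Y ⟩
  L ℕ.* Y                        ≡⟨ cong (L ℕ.*_) Y≡AX ⟩
  L ℕ.* (A ℕ.* X)                ≡⟨ swap L A X ⟩
  A ℕ.* (L ℕ.* X)                ≡⟨ cong (A ℕ.*_) (sym (gcd*lcm L X)) ⟩
  A ℕ.* (gcd L X ℕ.* lcm L X)    ≡⟨ swap A (gcd L X) (lcm L X) ⟩
  gcd L X ℕ.* (A ℕ.* lcm L X)    ∎)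
  where
  open ≡-Reasoning
  gcd≢0 : NonZero (gcd L X)
  gcd≢0 = ℕ.≢-nonZero (λ gcd≡0 → ℕP.<⇒≱ 1≤L (ℕP.≤-reflexive (gcd[m,n]≡0⇒m≡0 gcd≡0)))
  swap : ∀ a b c → a ℕ.* (b ℕ.* c) ≡ b ℕ.* (a ℕ.* c)
  swap = solve-∀ℕ

-- Here gcd L M = u, and gcd L M · lcm L M = L M.
lcm[D*u,M]≡D*M : ∀ {u M T L D} → 1 ≤ u → u ∣ M → M ∣ T → gcd L T ≡ u → L ≡ D ℕ.* u → lcm L M ≡ D ℕ.* M
lcm[D*u,M]≡D*M {u} {M} {T} {L} {D} 1≤u u∣M M∣T gcd[L,T]≡u L≡Du = ℕP.*-cancelˡ-≡ (lcm L M) (D ℕ.* M) u {{ℕ.>-nonZero 1≤u}} (begin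
  u ℕ.* lcm L M                  ≡⟨ cong (ℕ._* lcm L M) (sym gcd[L,M]≡u) ⟩
  gcd L M ℕ.* lcm L M            ≡⟨ gcd*lcm L M ⟩
  L ℕ.* M                        ≡⟨ cong (ℕ._* M) L≡Du ⟩
  D ℕ.* u ℕ.* M                  ≡⟨ regroup D u M ⟩
  u ℕ.* (D ℕ.* M)                ∎)
  where
  open ≡-Reasoning
  gcd[L,M]≡u : gcd L M ≡ u
  gcd[L,M]≡u = ∣-antisym (subst (gcd L M ∣_) gcd[L,T]≡u (gcd-greatest (gcd[m,n]∣m L M) (∣-trans (gcd[m,n]∣n L M) M∣T)))
                         (gcd-greatest (subst (_∣ L) gcd[L,T]≡u (gcd[m,n]∣m L T)) u∣M)
  regroup : ∀ d u m → d ℕ.* u ℕ.* m ≡ u ℕ.* (d ℕ.* m)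
  regroup = solve-∀ℕ

gcd-restrict : ∀ {L N y Y} → gcd L N ∣ y → Y ∣ N → gcd L Y ≡ gcd L (gcd y Y)
gcd-restrict {L} {N} {y} {Y} gcd[L,N]∣y Y∣N = ∣-antisym
  (gcd-greatest (gcd[m,n]∣m L Y) (gcd-greatest (∣-trans (gcd-greatest (gcd[m,n]∣m L Y) (∣-trans (gcd[m,n]∣n L Y) Y∣N)) gcd[L,N]∣y) (gcd[m,n]∣n L Y)))
  (gcd-greatest (gcd[m,n]∣m L (gcd y Y)) (∣-trans (gcd[m,n]∣n L (gcd y Y)) (gcd[m,n]∣n y Y)))

gcd₃ : ℕ → ℕ → ℕ → ℕ
gcd₃ a b c = gcd (gcd a b) (gcd a c)

∣gcd₃⇒ : ∀ {d a b c} → d ∣ gcd₃ a b c → d ∣ a × d ∣ b × d ∣ c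
∣gcd₃⇒ {d} {a} {b} {c} d∣g = ∣-trans d∣g (∣-trans (gcd[m,n]∣m (gcd a b) (gcd a c)) (gcd[m,n]∣m a b))
                          , ∣-trans d∣g (∣-trans (gcd[m,n]∣m (gcd a b) (gcd a c)) (gcd[m,n]∣n a b))
                          , ∣-trans d∣g (∣-trans (gcd[m,n]∣n (gcd a b) (gcd a c)) (gcd[m,n]∣n a c))

∣⇒∣gcd₃ : ∀ {d a b c} → d ∣ a → d ∣ b → d ∣ c → d ∣ gcd₃ a b c
∣⇒∣gcd₃ d∣a d∣b d∣c = gcd-greatest (gcd-greatest d∣a d∣b) (gcd-greatest d∣a d∣c)

gcd₃-swap₁₂ : ∀ a b c → gcd₃ b a c ≡ gcd₃ a b c
gcd₃-swap₁₂ a b c with ∣gcd₃⇒ {gcd₃ b a c} {b} {a} {c} ∣-refl | ∣gcd₃⇒ {gcd₃ a b c} {a} {b} {c} ∣-refl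
... | g∣b , g∣a , g∣c | g′∣a , g′∣b , g′∣c = ∣-antisym (∣⇒∣gcd₃ g∣a g∣b g∣c) (∣⇒∣gcd₃ g′∣b g′∣a g′∣c)

gcd₃-rotate : ∀ a b c → gcd₃ c a b ≡ gcd₃ a b c
gcd₃-rotate a b c with ∣gcd₃⇒ {gcd₃ c a b} {c} {a} {b} ∣-refl | ∣gcd₃⇒ {gcd₃ a b c} {a} {b} {c} ∣-refl
... | g∣c , g∣a , g∣b | g′∣a , g′∣b , g′∣c = ∣-antisym (∣⇒∣gcd₃ g∣a g∣b g∣c) (∣⇒∣gcd₃ g′∣c g′∣a g′∣b)

gcd[a,gcd[b,c]]≡gcd₃ : ∀ a b c → gcd a (gcd b c) ≡ gcd₃ a b c
gcd[a,gcd[b,c]]≡gcd₃ a b c with ∣gcd₃⇒ {gcd₃ a b c} {a} {b} {c} ∣-refl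
... | g∣a , g∣b , g∣c = ∣-antisym
  (∣⇒∣gcd₃ (gcd[m,n]∣m a (gcd b c)) (∣-trans (gcd[m,n]∣n a (gcd b c)) (gcd[m,n]∣m b c)) (∣-trans (gcd[m,n]∣n a (gcd b c)) (gcd[m,n]∣n b c)))
  (gcd-greatest g∣a (gcd-greatest g∣b g∣c))

-- Alternating sums and their divisibility

*-pres-∣ℤ : ∀ {a b c d} → a ∣ℤ b → c ∣ℤ d → a * c ∣ℤ b * d
*-pres-∣ℤ {a} {b} {c} {d} (ℤ∣.divides q b≡qa) (ℤ∣.divides r d≡rc) =
  ℤ∣.divides (q * r) (trans (cong₂ _*_ b≡qa d≡rc) (regroup q a r c))
  where
  regroup : ∀ q a r c → (q * a) * (r * c) ≡ (q * r) * (a * c)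
  regroup = solve-∀

∣ℤ-≡0 : ∀ {a b} → b ≡ 0ℤ → a ∣ℤ b
∣ℤ-≡0 {a} refl = ℤ∣.divides 0ℤ (sym (ℤP.*-zeroˡ a))

^-distrib-* : ∀ m n e → (m ℕ.* n) ℕ.^ e ≡ m ℕ.^ e ℕ.* n ℕ.^ e
^-distrib-* m n zero    = refl
^-distrib-* m n (suc e) = trans (cong (m ℕ.* n ℕ.*_) (^-distrib-* m n e)) (regroup m n (m ℕ.^ e) (n ℕ.^ e))
  where
  regroup : ∀ m n a b → (m ℕ.* n) ℕ.* (a ℕ.* b) ≡ (m ℕ.* a) ℕ.* (n ℕ.* b)
  regroup = solve-∀ℕ

pos-^-distrib-* : ∀ m n e → + ((m ℕ.* n) ℕ.^ e) ≡ + (m ℕ.^ e) * + (n ℕ.^ e)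
pos-^-distrib-* m n e = trans (cong +_ (^-distrib-* m n e)) (ℤP.pos-* (m ℕ.^ e) (n ℕ.^ e))

[x-1]∣[x^k-1] : ∀ x k → + x - 1ℤ ∣ℤ + (x ℕ.^ k) - 1ℤ
[x-1]∣[x^k-1] x zero    = ∣ℤ-≡0 refl
[x-1]∣[x^k-1] x (suc k) with [x-1]∣[x^k-1] x k
... | ℤ∣.divides q x^k-1≡q[x-1] = ℤ∣.divides (+ x * q + 1ℤ) (begin
  + (x ℕ.* x ℕ.^ k) - 1ℤ              ≡⟨ cong (_- 1ℤ) (ℤP.pos-* x (x ℕ.^ k)) ⟩
  + x * + (x ℕ.^ k) - 1ℤ              ≡⟨ telescope (+ x) (+ (x ℕ.^ k)) ⟩
  + x * (+ (x ℕ.^ k) - 1ℤ) + (+ x - 1ℤ) ≡⟨ cong (λ t → + x * t + (+ x - 1ℤ)) x^k-1≡q[x-1] ⟩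
  + x * (q * (+ x - 1ℤ)) + (+ x - 1ℤ) ≡⟨ factor (+ x) q ⟩
  (+ x * q + 1ℤ) * (+ x - 1ℤ)         ∎)
  where
  open ≡-Reasoning
  telescope : ∀ x y → x * y - 1ℤ ≡ x * (y - 1ℤ) + (x - 1ℤ)
  telescope = solve-∀
  factor : ∀ x q → x * (q * (x - 1ℤ)) + (x - 1ℤ) ≡ (x * q + 1ℤ) * (x - 1ℤ)
  factor = solve-∀

[x^a-1]∣[x^b-1] : ∀ x {a b} → a ∣ b → + (x ℕ.^ a) - 1ℤ ∣ℤ + (x ℕ.^ b) - 1ℤ
[x^a-1]∣[x^b-1] x {a} (divides k refl) =
  subst (λ t → + (x ℕ.^ a) - 1ℤ ∣ℤ + t - 1ℤ) (trans (ℕP.^-*-assoc x a k) (cong (x ℕ.^_) (ℕP.*-comm a k))) ([x-1]∣[x^k-1] (x ℕ.^ a) k)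

x^a∣x^b : ∀ x {a b} → a ≤ b → + (x ℕ.^ a) ∣ℤ + (x ℕ.^ b)
x^a∣x^b x {a} {b} a≤b = ℤ∣.divides (+ (x ℕ.^ (b ℕ.∸ a))) (begin
  + (x ℕ.^ b)                          ≡⟨ cong (λ e → + (x ℕ.^ e)) (sym (ℕP.m∸n+n≡m a≤b)) ⟩
  + (x ℕ.^ (b ℕ.∸ a ℕ.+ a))            ≡⟨ cong +_ (ℕP.^-distribˡ-+-* x (b ℕ.∸ a) a) ⟩
  + (x ℕ.^ (b ℕ.∸ a) ℕ.* x ℕ.^ a)      ≡⟨ ℤP.pos-* (x ℕ.^ (b ℕ.∸ a)) (x ℕ.^ a) ⟩
  + (x ℕ.^ (b ℕ.∸ a)) * + (x ℕ.^ a)    ∎)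
  where open ≡-Reasoning

ξ : ℕ → ℕ → ℤ
ξ a x = + (x ℕ.^ a)

Δ² : (ℕ → ℤ) → ℕ → ℕ → ℕ → ℕ → ℤ
Δ² h T P Q R = h T - h P - h Q + h R

Δ²-scale : ∀ e A (f : ℕ → ℕ) T P Q R →
  Δ² (λ V → ξ e (A ℕ.* f V)) T P Q R ≡ ξ e A * Δ² (λ V → ξ e (f V)) T P Q R
Δ²-scale e A f T P Q R = trans (cong₂ (λ t p → t - p - ξ e (A ℕ.* f Q) + ξ e (A ℕ.* f R)) (split T) (split P))
                        (trans (cong₂ (λ q r → ξ e A * ξ e (f T) - ξ e A * ξ e (f P) - q + r) (split Q) (split R))
                               (factor (ξ e A) (ξ e (f T)) (ξ e (f P)) (ξ e (f Q)) (ξ e (f R))))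
  where
  split : ∀ V → ξ e (A ℕ.* f V) ≡ ξ e A * ξ e (f V)
  split V = pos-^-distrib-* A (f V) e
  factor : ∀ a t p q r → a * t - a * p - a * q + a * r ≡ a * (t - p - q + r)
  factor = solve-∀

Δ²-ξ-factor : ∀ e B C R → Δ² (ξ e) (B ℕ.* C ℕ.* R) (C ℕ.* R) (B ℕ.* R) R ≡ ξ e R * ((ξ e B - 1ℤ) * (ξ e C - 1ℤ))
Δ²-ξ-factor e B C R = begin
  ξ e (B ℕ.* C ℕ.* R) - ξ e (C ℕ.* R) - ξ e (B ℕ.* R) + ξ e R
    ≡⟨ cong₂ (λ t p → t - p - ξ e (B ℕ.* R) + ξ e R)
             (trans (pos-^-distrib-* (B ℕ.* C) R e) (cong (_* ξ e R) (pos-^-distrib-* B C e))) (pos-^-distrib-* C R e) ⟩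
  ξ e B * ξ e C * ξ e R - ξ e C * ξ e R - ξ e (B ℕ.* R) + ξ e R
    ≡⟨ cong (λ q → ξ e B * ξ e C * ξ e R - ξ e C * ξ e R - q + ξ e R) (pos-^-distrib-* B R e) ⟩
  ξ e B * ξ e C * ξ e R - ξ e C * ξ e R - ξ e B * ξ e R + ξ e R
    ≡⟨ factor (ξ e B) (ξ e C) (ξ e R) ⟩
  ξ e R * ((ξ e B - 1ℤ) * (ξ e C - 1ℤ))
    ∎
  where
  open ≡-Reasoning
  factor : ∀ b c r → b * c * r - c * r - b * r + r ≡ r * ((b - 1ℤ) * (c - 1ℤ))
  factor = solve-∀

Δ²-degenerateˡ : ∀ h T P Q R → h Q ≡ h T → h R ≡ h P → Δ² h T P Q R ≡ 0ℤ
Δ²-degenerateˡ h T P Q R hQ≡hT hR≡hP = trans (cong₂ (λ q r → h T - h P - q + r) hQ≡hT hR≡hP) (cancel (h T) (h P))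
  where
  cancel : ∀ t p → t - p - t + p ≡ 0ℤ
  cancel = solve-∀

Δ²-degenerateʳ : ∀ h T P Q R → h P ≡ h T → h R ≡ h Q → Δ² h T P Q R ≡ 0ℤ
Δ²-degenerateʳ h T P Q R hP≡hT hR≡hQ = trans (cong₂ (λ p r → h T - p - h Q + r) hP≡hT hR≡hQ) (cancel (h T) (h Q))
  where
  cancel : ∀ t q → t - t - q + q ≡ 0ℤ
  cancel = solve-∀

-- Writing P = C R and Q = B R gives T = B C R, so Δ² (ξ e) T P Q R = R^e (B^e − 1) (C^e − 1).
Δ²-ξ-∣ : ∀ {a b} T P Q R → a ∣ b → a ≤ b → 1 ≤ R → lcm P Q ≡ T → gcd P Q ≡ R → Δ² (ξ a) T P Q R ∣ℤ Δ² (ξ b) T P Q R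
Δ²-ξ-∣ {a} {b} T P Q R a∣b a≤b 1≤R lcm≡T gcd≡R with gcd[m,n]∣m P Q | gcd[m,n]∣n P Q
... | divides C P≡C*gcd | divides B Q≡B*gcd =
  subst₂ _∣ℤ_ (sym (factored a)) (sym (factored b)) (*-pres-∣ℤ (x^a∣x^b R a≤b) (*-pres-∣ℤ ([x^a-1]∣[x^b-1] B a∣b) ([x^a-1]∣[x^b-1] C a∣b)))
  where
  P≡CR : P ≡ C ℕ.* R
  P≡CR = trans P≡C*gcd (cong (C ℕ.*_) gcd≡R)
  Q≡BR : Q ≡ B ℕ.* R
  Q≡BR = trans Q≡B*gcd (cong (B ℕ.*_) gcd≡R)
  T≡BCR : T ≡ B ℕ.* C ℕ.* R
  T≡BCR = ℕP.*-cancelˡ-≡ T (B ℕ.* C ℕ.* R) R {{ℕ.>-nonZero 1≤R}} (begin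
    R ℕ.* T                    ≡⟨ cong₂ ℕ._*_ (sym gcd≡R) (sym lcm≡T) ⟩
    gcd P Q ℕ.* lcm P Q        ≡⟨ gcd*lcm P Q ⟩
    P ℕ.* Q                    ≡⟨ cong₂ ℕ._*_ P≡CR Q≡BR ⟩
    C ℕ.* R ℕ.* (B ℕ.* R)      ≡⟨ regroup C R B ⟩
    R ℕ.* (B ℕ.* C ℕ.* R)      ∎)
    where
    open ≡-Reasoning
    regroup : ∀ c r b → c ℕ.* r ℕ.* (b ℕ.* r) ≡ r ℕ.* (b ℕ.* c ℕ.* r)
    regroup = solve-∀ℕ
  factored : ∀ e → Δ² (ξ e) T P Q R ≡ ξ e R * ((ξ e B - 1ℤ) * (ξ e C - 1ℤ))
  factored e = trans (cong₂ (λ t (p , q) → Δ² (ξ e) t p q R) T≡BCR (cong₂ _,_ P≡CR Q≡BR)) (Δ²-ξ-factor e B C R)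

Δ³ : (ℕ → ℤ) → ℕ → ℕ → ℕ → ℕ → ℤ
Δ³ h N y₁ y₂ y₃ = h N - h y₁ - h y₂ - h y₃ + h (gcd y₁ y₂) + h (gcd y₁ y₃) + h (gcd y₂ y₃) - h (gcd₃ y₁ y₂ y₃)

Δ³-cong : ∀ (P : ℕ → Set) {h h′ : ℕ → ℤ} {N y₁ y₂ y₃} → (∀ {u v} → P u → P v → P (gcd u v)) →
  P N → P y₁ → P y₂ → P y₃ → (∀ {M} → P M → h M ≡ h′ M) → Δ³ h N y₁ y₂ y₃ ≡ Δ³ h′ N y₁ y₂ y₃
Δ³-cong P P-gcd pN p₁ p₂ p₃ h≡h′ =
  cong₂ _-_ (cong₂ _+_ (cong₂ _+_ (cong₂ _+_ (cong₂ _-_ (cong₂ _-_ (cong₂ _-_ (h≡h′ pN) (h≡h′ p₁)) (h≡h′ p₂)) (h≡h′ p₃))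
                                              (h≡h′ (P-gcd p₁ p₂))) (h≡h′ (P-gcd p₁ p₃))) (h≡h′ (P-gcd p₂ p₃)))
            (h≡h′ (P-gcd (P-gcd p₁ p₂) (P-gcd p₁ p₃)))

Δ³-cong-∣ : ∀ {h h′ : ℕ → ℤ} {N y₁ y₂ y₃} → y₁ ∣ N → y₂ ∣ N → y₃ ∣ N → (∀ {M} → M ∣ N → h M ≡ h′ M) →
  Δ³ h N y₁ y₂ y₃ ≡ Δ³ h′ N y₁ y₂ y₃
Δ³-cong-∣ {N = N} = Δ³-cong (_∣ N) (λ {u} {v} u∣N _ → ∣-trans (gcd[m,n]∣m u v) u∣N) ∣-refl

Δ³-swap₁₂ : ∀ h N a b c → Δ³ h N b a c ≡ Δ³ h N a b c
Δ³-swap₁₂ h N a b c = trans (cong₂ (λ ba bac → h N - h b - h a - h c + h ba + h (gcd b c) + h (gcd a c) - h bac) (gcd-comm b a) (gcd₃-swap₁₂ a b c))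
                            (reorder (h N) (h b) (h a) (h c) (h (gcd a b)) (h (gcd b c)) (h (gcd a c)) (h (gcd₃ a b c)))
  where
  reorder : ∀ n b a c ab bc ac w → n - b - a - c + ab + bc + ac - w ≡ n - a - b - c + ab + ac + bc - w
  reorder = solve-∀

Δ³-rotate : ∀ h N a b c → Δ³ h N c a b ≡ Δ³ h N a b c
Δ³-rotate h N a b c = trans (cong₂ (λ ca cb → h N - h c - h a - h b + h ca + h cb + h (gcd a b) - h (gcd₃ c a b)) (gcd-comm c a) (gcd-comm c b))
                     (trans (cong (λ w → h N - h c - h a - h b + h (gcd a c) + h (gcd b c) + h (gcd a b) - h w) (gcd₃-rotate a b c))
                            (reorder (h N) (h c) (h a) (h b) (h (gcd a c)) (h (gcd b c)) (h (gcd a b)) (h (gcd₃ a b c))))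
  where
  reorder : ∀ n c a b ac bc ab w → n - c - a - b + ac + bc + ab - w ≡ n - a - b - c + ab + ac + bc - w
  reorder = solve-∀

Δ³≡Δ²-Δ² : ∀ (g h : ℕ → ℤ) N y₁ y₂ y₃ →
  h N ≡ g y₁ → h y₂ ≡ g (gcd y₁ y₂) → h y₃ ≡ g (gcd y₁ y₃) → h (gcd y₂ y₃) ≡ g (gcd₃ y₁ y₂ y₃) →
  Δ³ h N y₁ y₂ y₃ ≡ Δ² g y₁ (gcd y₁ y₂) (gcd y₁ y₃) (gcd₃ y₁ y₂ y₃) - Δ² h y₁ (gcd y₁ y₂) (gcd y₁ y₃) (gcd₃ y₁ y₂ y₃)
Δ³≡Δ²-Δ² g h N y₁ y₂ y₃ hN hy₂ hy₃ hy₂₃ =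
  trans (cong₂ (λ n (t₂ , t₃ , t₂₃) → n - h y₁ - t₂ - t₃ + h (gcd y₁ y₂) + h (gcd y₁ y₃) + t₂₃ - h (gcd₃ y₁ y₂ y₃))
               hN (cong₂ _,_ hy₂ (cong₂ _,_ hy₃ hy₂₃)))
        (regroup (g y₁) (h y₁) (g (gcd y₁ y₂)) (g (gcd y₁ y₃)) (h (gcd y₁ y₂)) (h (gcd y₁ y₃)) (g (gcd₃ y₁ y₂ y₃)) (h (gcd₃ y₁ y₂ y₃)))
  where
  regroup : ∀ g₁ h₁ g₂ g₃ h₂ h₃ g₄ h₄ → g₁ - h₁ - g₂ - g₃ + h₂ + h₃ + g₄ - h₄ ≡ (g₁ - g₂ - g₃ + g₄) - (h₁ - h₂ - h₃ + h₄)
  regroup = solve-∀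

Δ³-ξ-factor : ∀ e A (f : ℕ → ℕ) N y₁ y₂ y₃ →
  f N ≡ A ℕ.* f y₁ → f y₂ ≡ A ℕ.* f (gcd y₁ y₂) → f y₃ ≡ A ℕ.* f (gcd y₁ y₃) → f (gcd y₂ y₃) ≡ A ℕ.* f (gcd₃ y₁ y₂ y₃) →
  Δ³ (λ V → ξ e (f V)) N y₁ y₂ y₃ ≡ (ξ e A - 1ℤ) * Δ² (λ V → ξ e (f V)) y₁ (gcd y₁ y₂) (gcd y₁ y₃) (gcd₃ y₁ y₂ y₃)
Δ³-ξ-factor e A f N y₁ y₂ y₃ fN fy₂ fy₃ fy₂₃ = begin
  Δ³ hf N y₁ y₂ y₃
    ≡⟨ Δ³≡Δ²-Δ² (λ V → ξ e (A ℕ.* f V)) hf N y₁ y₂ y₃ (cong (ξ e) fN) (cong (ξ e) fy₂) (cong (ξ e) fy₃) (cong (ξ e) fy₂₃) ⟩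
  Δ² (λ V → ξ e (A ℕ.* f V)) y₁ z₁₂ z₁₃ w - D
    ≡⟨ cong (_- D) (Δ²-scale e A f y₁ z₁₂ z₁₃ w) ⟩
  ξ e A * D - D
    ≡⟨ factor (ξ e A) D ⟩
  (ξ e A - 1ℤ) * D ∎
  where
  open ≡-Reasoning
  hf : ℕ → ℤ
  hf V = ξ e (f V)
  z₁₂ z₁₃ w : ℕ
  z₁₂ = gcd y₁ y₂
  z₁₃ = gcd y₁ y₃
  w = gcd₃ y₁ y₂ y₃
  D : ℤ
  D = Δ² hf y₁ z₁₂ z₁₃ w
  factor : ∀ a d → a * d - d ≡ (a - 1ℤ) * d
  factor = solve-∀

Δ³-degenerate : ∀ h N y₁ y₂ y₃ →
  h N ≡ h y₁ → h y₂ ≡ h (gcd y₁ y₂) → h y₃ ≡ h (gcd y₁ y₃) → h (gcd y₂ y₃) ≡ h (gcd₃ y₁ y₂ y₃) →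
  Δ³ h N y₁ y₂ y₃ ≡ 0ℤ
Δ³-degenerate h N y₁ y₂ y₃ hN hy₂ hy₃ hy₂₃ =
  trans (Δ³≡Δ²-Δ² h h N y₁ y₂ y₃ hN hy₂ hy₃ hy₂₃) (ℤP.+-inverseʳ (Δ² h y₁ (gcd y₁ y₂) (gcd y₁ y₃) (gcd₃ y₁ y₂ y₃)))

Δ³-*ʳ : ∀ (h : ℕ → ℤ) v N y₁ y₂ y₃ → Δ³ (λ M → h M * v) N y₁ y₂ y₃ ≡ Δ³ h N y₁ y₂ y₃ * v
Δ³-*ʳ h v N y₁ y₂ y₃ = distrib (h N) (h y₁) (h y₂) (h y₃) (h (gcd y₁ y₂)) (h (gcd y₁ y₃)) (h (gcd y₂ y₃)) (h (gcd₃ y₁ y₂ y₃)) v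
  where
  distrib : ∀ a b c d e f g k v → a * v - b * v - c * v - d * v + e * v + f * v + g * v - k * v ≡ (a - b - c - d + e + f + g - k) * v
  distrib = solve-∀

χ-Δ³ : ∀ b (h : ℕ → ℤ) N y₁ y₂ y₃ → χ b (Δ³ h N y₁ y₂ y₃) ≡ Δ³ (λ M → χ b (h M)) N y₁ y₂ y₃
χ-Δ³ true  h N y₁ y₂ y₃ = refl
χ-Δ³ false h N y₁ y₂ y₃ = refl

module _ {X : Set} (S : (X → ℤ) → ℤ) (S-+ : ∀ f g → S (λ e → f e + g e) ≡ S f + S g) (S-neg : ∀ f → S (λ e → - f e) ≡ - S f) where

  private
    S-sub : ∀ f g → S (λ e → f e - g e) ≡ S f - S g
    S-sub f g = trans (S-+ f (λ e → - g e)) (cong (_+_ (S f)) (S-neg g))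

  additive-Δ³ : ∀ (H : X → ℕ → ℤ) N y₁ y₂ y₃ → S (λ e → Δ³ (H e) N y₁ y₂ y₃) ≡ Δ³ (λ M → S (λ e → H e M)) N y₁ y₂ y₃
  additive-Δ³ H N y₁ y₂ y₃ =
    trans (S-sub _ (at (gcd₃ y₁ y₂ y₃))) (cong (_- S (at (gcd₃ y₁ y₂ y₃)))
    (trans (S-+ _ (at (gcd y₂ y₃))) (cong (_+ S (at (gcd y₂ y₃)))
    (trans (S-+ _ (at (gcd y₁ y₃))) (cong (_+ S (at (gcd y₁ y₃)))
    (trans (S-+ _ (at (gcd y₁ y₂))) (cong (_+ S (at (gcd y₁ y₂)))
    (trans (S-sub _ (at y₃)) (cong (_- S (at y₃))
    (trans (S-sub _ (at y₂)) (cong (_- S (at y₂))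
    (S-sub (at N) (at y₁)))))))))))))
    where
    at : ℕ → X → ℤ
    at M e = H e M

inclusion-exclusion : ∀ bN b₁ b₂ b₃ → b₁ ≡ bN ∧ b₁ → b₂ ≡ bN ∧ b₂ → b₃ ≡ bN ∧ b₃ →
  χ (bN ∧ not b₁ ∧ not b₂ ∧ not b₃) 1ℤ ≡
  χ bN 1ℤ - χ b₁ 1ℤ - χ b₂ 1ℤ - χ b₃ 1ℤ
    + χ (b₁ ∧ b₂) 1ℤ + χ (b₁ ∧ b₃) 1ℤ + χ (b₂ ∧ b₃) 1ℤ - χ ((b₁ ∧ b₂) ∧ (b₁ ∧ b₃)) 1ℤ
inclusion-exclusion true  true  true  true  _ _ _ = refl
inclusion-exclusion true  true  true  false _ _ _ = refl
inclusion-exclusion true  true  false true  _ _ _ = refl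
inclusion-exclusion true  true  false false _ _ _ = refl
inclusion-exclusion true  false true  true  _ _ _ = refl
inclusion-exclusion true  false true  false _ _ _ = refl
inclusion-exclusion true  false false true  _ _ _ = refl
inclusion-exclusion true  false false false _ _ _ = refl
inclusion-exclusion false false false false _ _ _ = refl
inclusion-exclusion false true  _     _     () _  _
inclusion-exclusion false false true  _     _  () _
inclusion-exclusion false false false true  _  _  ()

does-∣gcd : ∀ e A B → does (e ∣? gcd A B) ≡ does (e ∣? A) ∧ does (e ∣? B)
does-∣gcd e A B = does-⇔ (mk⇔ (λ e∣g → ∣-trans e∣g (gcd[m,n]∣m A B) , ∣-trans e∣g (gcd[m,n]∣n A B)) (λ (e∣A , e∣B) → gcd-greatest e∣A e∣B))
                         (e ∣? gcd A B) ((e ∣? A) ×-dec (e ∣? B))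

does-∣-∣ : ∀ e {Y N} → Y ∣ N → does (e ∣? Y) ≡ does (e ∣? N) ∧ does (e ∣? Y)
does-∣-∣ e {Y} {N} Y∣N = does-⇔ (mk⇔ (λ e∣Y → ∣-trans e∣Y Y∣N , e∣Y) proj₂) (e ∣? Y) ((e ∣? N) ×-dec (e ∣? Y))

χ∣-inclusion-exclusion : ∀ e v {N y₁ y₂ y₃} → y₁ ∣ N → y₂ ∣ N → y₃ ∣ N →
  χ (does ((e ∣? N) ×-dec ¬? (e ∣? y₁) ×-dec ¬? (e ∣? y₂) ×-dec ¬? (e ∣? y₃))) v ≡ Δ³ (λ M → χ (does (e ∣? M)) v) N y₁ y₂ y₃
χ∣-inclusion-exclusion e v {N} {y₁} {y₂} {y₃} y₁∣N y₂∣N y₃∣N = begin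
  χ (b N ∧ not (b y₁) ∧ not (b y₂) ∧ not (b y₃)) v
    ≡⟨ χ≡χ1* _ v ⟩
  χ (b N ∧ not (b y₁) ∧ not (b y₂) ∧ not (b y₃)) 1ℤ * v
    ≡⟨ cong (_* v) (inclusion-exclusion (b N) (b y₁) (b y₂) (b y₃) (does-∣-∣ e y₁∣N) (does-∣-∣ e y₂∣N) (does-∣-∣ e y₃∣N)) ⟩
  (χ (b N) 1ℤ - χ (b y₁) 1ℤ - χ (b y₂) 1ℤ - χ (b y₃) 1ℤ + χ (b y₁ ∧ b y₂) 1ℤ + χ (b y₁ ∧ b y₃) 1ℤ + χ (b y₂ ∧ b y₃) 1ℤ
    - χ ((b y₁ ∧ b y₂) ∧ (b y₁ ∧ b y₃)) 1ℤ) * v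
    ≡⟨ cong (_* v) (sym at-gcds) ⟩
  Δ³ (λ M → χ (b M) 1ℤ) N y₁ y₂ y₃ * v
    ≡⟨ sym (Δ³-*ʳ (λ M → χ (b M) 1ℤ) v N y₁ y₂ y₃) ⟩
  Δ³ (λ M → χ (b M) 1ℤ * v) N y₁ y₂ y₃
    ≡⟨ Δ³-cong (λ _ → ⊤) _ tt tt tt tt (λ {M} _ → sym (χ≡χ1* (b M) v)) ⟩
  Δ³ (λ M → χ (b M) v) N y₁ y₂ y₃ ∎
  where
  open ≡-Reasoning
  b : ℕ → Bool
  b M = does (e ∣? M)
  χb : ℕ → ℤ
  χb M = χ (b M) 1ℤ
  at-gcds : Δ³ χb N y₁ y₂ y₃ ≡ χ (b N) 1ℤ - χ (b y₁) 1ℤ - χ (b y₂) 1ℤ - χ (b y₃) 1ℤ + χ (b y₁ ∧ b y₂) 1ℤ + χ (b y₁ ∧ b y₃) 1ℤ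
                                 + χ (b y₂ ∧ b y₃) 1ℤ - χ ((b y₁ ∧ b y₂) ∧ (b y₁ ∧ b y₃)) 1ℤ
  at-gcds = cong₂ (λ (s₁₂ , s₁₃) (s₂₃ , s) → χb N - χb y₁ - χb y₂ - χb y₃ + s₁₂ + s₁₃ + s₂₃ - s)
    (cong₂ _,_ (cong (λ c → χ c 1ℤ) (does-∣gcd e y₁ y₂)) (cong (λ c → χ c 1ℤ) (does-∣gcd e y₁ y₃)))
    (cong₂ _,_ (cong (λ c → χ c 1ℤ) (does-∣gcd e y₂ y₃))
               (cong (λ c → χ c 1ℤ) (trans (does-∣gcd e (gcd y₁ y₂) (gcd y₁ y₃)) (cong₂ _∧_ (does-∣gcd e y₁ y₂) (does-∣gcd e y₁ y₃)))))

-- Greatest-type divisors in a gcd-closed set satisfying 𝒢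

module GcdClosedSet {n : ℕ} (x : Fin n → ℕ) (pos : ∀ i → 0 < x i) (gc : GcdClosed x) (G : SatisfiesG x) where

  instance
    x≢0 : ∀ {i} → NonZero (x i)
    x≢0 {i} = ℕ.>-nonZero (pos i)

  ∣⇒≤ₓ : ∀ {i j} → x i ∣ x j → x i ≤ x j
  ∣⇒≤ₓ {i} {j} = ∣⇒≤ {{x≢0 {j}}}

  ∃greatestType-above : ∀ z u → x u ∣ x z → x u < x z → ∃ λ t → GreatestType x t z × x u ∣ x t
  ∃greatestType-above z u u∣z u<z = climb u (<-wellFounded (x z ℕ.∸ x u)) ∣-refl u∣z u<z
    where
    climb : ∀ t → Acc _<_ (x z ℕ.∸ x t) → x u ∣ x t → x t ∣ x z → x t < x z → ∃ λ t → GreatestType x t z × x u ∣ x t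
    climb t (acc rs) u∣t t∣z t<z with any? (λ k → ((x t ∣? x k) ×-dec (x k ∣? x z)) ×-dec ((x t ℕ.<? x k) ×-dec (x k ℕ.<? x z)))
    ... | yes (k , (t∣k , k∣z) , (t<k , k<z)) = climb k (rs (ℕP.∸-monoʳ-< t<k (ℕP.<⇒≤ k<z))) (∣-trans u∣t t∣k) k∣z k<z
    ... | no  nothing-between = t , (t<z , t∣z , maximal) , u∣t
      where
      maximal : ∀ k → x t ∣ x k → x k ∣ x z → (x k ≡ x t) ⊎ (x k ≡ x z)
      maximal k t∣k k∣z with x k ℕ.≟ x t | x k ℕ.≟ x z
      ... | yes k≡t | _       = inj₁ k≡t
      ... | no  _   | yes k≡z = inj₂ k≡z
      ... | no  k≢t | no  k≢z =
        ⊥-elim (nothing-between (k , (t∣k , k∣z) , ℕP.≤∧≢⇒< (∣⇒≤ₓ t∣k) (λ t≡k → k≢t (sym t≡k)) , ℕP.≤∧≢⇒< (∣⇒≤ₓ k∣z) k≢z))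

  greatestType-dichotomy : ∀ z w u → GreatestType x w z → x u ∣ x z → x u ∣ x w ⊎ lcm (x u) (x w) ≡ x z
  greatestType-dichotomy z w u = go z (<-wellFounded (x z)) w
    where
    go : ∀ z → Acc _<_ (x z) → ∀ w → GreatestType x w z → x u ∣ x z → x u ∣ x w ⊎ lcm (x u) (x w) ≡ x z
    go z (acc rs) w gt@(_ , w∣z , _) u∣z with x u ∣? x w | x u ℕ.≟ x z
    ... | yes u∣w | _       = inj₁ u∣w
    ... | no  u∤w | yes u≡z = inj₂ (∣-antisym (lcm-least (∣-reflexive u≡z) w∣z) (subst (_∣ lcm (x u) (x w)) u≡z (m∣lcm[m,n] _ _)))
    ... | no  u∤w | no  u≢z with ∃greatestType-above z u u∣z (ℕP.≤∧≢⇒< (∣⇒≤ₓ u∣z) u≢z)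
    ...   | t , gt′@(t<z , _ , _) , u∣t with x t ℕ.≟ x w
    ...     | yes t≡w = ⊥-elim (u∤w (subst (x u ∣_) t≡w u∣t))
    ...     | no  t≢w with G z t w gt′ gt t≢w
    ...       | lcm[t,w]≡z , s , _ , gt-st , (_ , s∣w , _) with go t (rs t<z) s gt-st u∣t
    ...         | inj₁ u∣s = ⊥-elim (u∤w (∣-trans u∣s s∣w))
    ...         | inj₂ lcm[u,s]≡t =
      inj₂ (∣-antisym (lcm-least u∣z w∣z) (subst (_∣ lcm (x u) (x w)) lcm[t,w]≡z (lcm-least t∣lcm (n∣lcm[m,n] (x u) (x w)))))
      where
      t∣lcm : x t ∣ lcm (x u) (x w)
      t∣lcm = subst (_∣ lcm (x u) (x w)) lcm[u,s]≡t (lcm-least (m∣lcm[m,n] (x u) (x w)) (∣-trans s∣w (n∣lcm[m,n] (x u) (x w))))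

  module GreatestTypeSquare {l t p q r : Fin n} (gt-p : GreatestType x p t) (gt-q : GreatestType x q t) (p≢q : ¬ x p ≡ x q)
                            (lcm[p,q]≡t : lcm (x p) (x q) ≡ x t) (r≡gcd : x r ≡ gcd (x p) (x q))
                            (gt-rp : GreatestType x r p) (gt-rq : GreatestType x r q) (b : ℕ) where

    private
      L T P Q R : ℕ
      L = x l ; T = x t ; P = x p ; Q = x q ; R = x r
      ku : Fin n
      ku = proj₁ (gc l t)
      u : ℕ
      u = x ku
      u≡gcd : u ≡ gcd L T
      u≡gcd = proj₂ (gc l t)
      P∣T : P ∣ T
      P∣T = proj₁ (proj₂ gt-p)
      Q∣T : Q ∣ T
      Q∣T = proj₁ (proj₂ gt-q)
      R∣P : R ∣ P
      R∣P = proj₁ (proj₂ gt-rp)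
      R∣Q : R ∣ Q
      R∣Q = proj₁ (proj₂ gt-rq)
      R∣T : R ∣ T
      R∣T = ∣-trans R∣P P∣T
      u∣L : u ∣ L
      u∣L = subst (_∣ L) (sym u≡gcd) (gcd[m,n]∣m L T)
      u∣T : u ∣ T
      u∣T = subst (_∣ T) (sym u≡gcd) (gcd[m,n]∣n L T)

    h : ℕ → ℤ
    h M = ξ b (lcm L M)

    private
      h-absorb : ∀ {X Y} → X ∣ Y → lcm u X ≡ Y → h X ≡ h Y
      h-absorb X∣Y lcm≡Y = cong (ξ b) (lcm-absorb u∣L X∣Y lcm≡Y)

      lcm≡T⇒≡T : ∀ {X g} → g ∣ u → lcm g R ≡ X → lcm u X ≡ T → lcm u R ≡ T
      lcm≡T⇒≡T {X} {g} g∣u lcm[g,R]≡X lcm[u,X]≡T = trans (lcm-absorb g∣u (subst (R ∣_) lcm[g,R]≡X (n∣lcm[m,n] g R)) lcm[g,R]≡X) lcm[u,X]≡T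

      gcd-below : ∀ X → R ∣ X → gcd u X ∣ R → gcd u X ≡ gcd u R
      gcd-below X R∣X gcd∣R = ∣-antisym (gcd-greatest (gcd[m,n]∣m u X) gcd∣R) (gcd-greatest (gcd[m,n]∣m u R) (∣-trans (gcd[m,n]∣n u R) R∣X))

      R-above : lcm u P ≡ T → lcm u Q ≡ T → lcm u R ≡ T → Δ² h T P Q R ≡ 0ℤ
      R-above lcm[u,P]≡T lcm[u,Q]≡T lcm[u,R]≡T =
        Δ²-degenerateˡ h T P Q R (h-absorb Q∣T lcm[u,Q]≡T) (trans (h-absorb R∣T lcm[u,R]≡T) (sym (h-absorb P∣T lcm[u,P]≡T)))

      bothAbove : lcm u P ≡ T → lcm u Q ≡ T → Δ² h T P Q R ≡ 0ℤ
      bothAbove lcm[u,P]≡T lcm[u,Q]≡T with gc ku p | gc ku q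
      ... | k₁ , k₁≡gcd | k₂ , k₂≡gcd
        with greatestType-dichotomy p r k₁ gt-rp (subst (_∣ P) (sym k₁≡gcd) (gcd[m,n]∣n u P))
           | greatestType-dichotomy q r k₂ gt-rq (subst (_∣ Q) (sym k₂≡gcd) (gcd[m,n]∣n u Q))
      ... | inj₂ lcm[g₁,R]≡P | _ = R-above lcm[u,P]≡T lcm[u,Q]≡T (lcm≡T⇒≡T (subst (_∣ u) (sym k₁≡gcd) (gcd[m,n]∣m u P)) lcm[g₁,R]≡P lcm[u,P]≡T)
      ... | inj₁ _ | inj₂ lcm[g₂,R]≡Q = R-above lcm[u,P]≡T lcm[u,Q]≡T (lcm≡T⇒≡T (subst (_∣ u) (sym k₂≡gcd) (gcd[m,n]∣m u Q)) lcm[g₂,R]≡Q lcm[u,Q]≡T)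
      ... | inj₁ g₁∣R | inj₁ g₂∣R = ⊥-elim (p≢q (ℕP.*-cancelˡ-≡ P Q u {{ℕ.>-nonZero (pos ku)}} (begin
        u ℕ.* P                ≡⟨ sym (gcd*lcm u P) ⟩
        gcd u P ℕ.* lcm u P    ≡⟨ cong₂ ℕ._*_ (gcd-below P R∣P (subst (_∣ R) k₁≡gcd g₁∣R)) lcm[u,P]≡T ⟩
        gcd u R ℕ.* T          ≡⟨ cong₂ ℕ._*_ (sym (gcd-below Q R∣Q (subst (_∣ R) k₂≡gcd g₂∣R))) (sym lcm[u,Q]≡T) ⟩
        gcd u Q ℕ.* lcm u Q    ≡⟨ gcd*lcm u Q ⟩
        u ℕ.* Q                ∎)))
        where open ≡-Reasoning

    below⊎Δ²≡0 : (u ∣ P × u ∣ Q) ⊎ Δ² h T P Q R ≡ 0ℤ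
    below⊎Δ²≡0 with greatestType-dichotomy t p ku gt-p u∣T | greatestType-dichotomy t q ku gt-q u∣T
    ... | inj₁ u∣P | inj₁ u∣Q = inj₁ (u∣P , u∣Q)
    ... | inj₁ u∣P | inj₂ lcm[u,Q]≡T with greatestType-dichotomy p r ku gt-rp u∣P
    ...   | inj₁ u∣R = ⊥-elim (ℕP.<-irrefl (trans (sym (m∣n⇒lcm[m,n]≡n (∣-trans u∣R R∣Q))) lcm[u,Q]≡T) (proj₁ gt-q))
    ...   | inj₂ lcm[u,R]≡P = inj₂ (Δ²-degenerateˡ h T P Q R (h-absorb Q∣T lcm[u,Q]≡T) (h-absorb R∣P lcm[u,R]≡P))
    below⊎Δ²≡0 | inj₂ lcm[u,P]≡T | inj₁ u∣Q with greatestType-dichotomy q r ku gt-rq u∣Q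
    ...   | inj₁ u∣R = ⊥-elim (ℕP.<-irrefl (trans (sym (m∣n⇒lcm[m,n]≡n (∣-trans u∣R R∣P))) lcm[u,P]≡T) (proj₁ gt-p))
    ...   | inj₂ lcm[u,R]≡Q = inj₂ (Δ²-degenerateʳ h T P Q R (h-absorb P∣T lcm[u,P]≡T) (h-absorb R∣Q lcm[u,R]≡Q))
    below⊎Δ²≡0 | inj₂ lcm[u,P]≡T | inj₂ lcm[u,Q]≡T = inj₂ (bothAbove lcm[u,P]≡T lcm[u,Q]≡T)

    Δ²-lcm-∣ : ∀ {a} → a ∣ b → a ≤ b → Δ² (ξ a) T P Q R ∣ℤ Δ² h T P Q R
    Δ²-lcm-∣ {a} a∣b a≤b with below⊎Δ²≡0
    ... | inj₂ Δ²≡0 = ∣ℤ-≡0 Δ²≡0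
    ... | inj₁ (u∣P , u∣Q) =
      subst (Δ² (ξ a) T P Q R ∣ℤ_) (sym scaled) (ℤ∣.∣n⇒∣m*n (ξ b D) (Δ²-ξ-∣ T P Q R a∣b a≤b (pos r) lcm[p,q]≡t (sym r≡gcd)))
      where
      D : ℕ
      D = _∣_.quotient u∣L
      u∣R : u ∣ R
      u∣R = subst (u ∣_) (sym r≡gcd) (gcd-greatest u∣P u∣Q)
      h≡ : ∀ {M} → u ∣ M → M ∣ T → h M ≡ ξ b (D ℕ.* M)
      h≡ u∣M M∣T = cong (ξ b) (lcm[D*u,M]≡D*M {D = D} (pos ku) u∣M M∣T (sym u≡gcd) (_∣_.equality u∣L))
      scaled : Δ² h T P Q R ≡ ξ b D * Δ² (ξ b) T P Q R
      scaled = trans (cong₂ (λ (t , p) (q , r) → t - p - q + r)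
                            (cong₂ _,_ (h≡ u∣T ∣-refl) (h≡ u∣P P∣T)) (cong₂ _,_ (h≡ u∣Q Q∣T) (h≡ u∣R R∣T)))
                     (Δ²-scale b D (λ M → M) T P Q R)

  module ThreeGreatestType {m i₁ i₂ i₃ : Fin n} (gt₁ : GreatestType x i₁ m) (gt₂ : GreatestType x i₂ m) (gt₃ : GreatestType x i₃ m)
                           (y₁≢y₂ : ¬ x i₁ ≡ x i₂) (y₁≢y₃ : ¬ x i₁ ≡ x i₃) (y₂≢y₃ : ¬ x i₂ ≡ x i₃) where

    N y₁ y₂ y₃ z₁₂ z₁₃ z₂₃ w : ℕ
    N = x m ; y₁ = x i₁ ; y₂ = x i₂ ; y₃ = x i₃
    z₁₂ = gcd y₁ y₂ ; z₁₃ = gcd y₁ y₃ ; z₂₃ = gcd y₂ y₃ ; w = gcd₃ y₁ y₂ y₃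

    private
      y₁∣N : y₁ ∣ N
      y₁∣N = proj₁ (proj₂ gt₁)
      y₂∣N : y₂ ∣ N
      y₂∣N = proj₁ (proj₂ gt₂)
      y₃∣N : y₃ ∣ N
      y₃∣N = proj₁ (proj₂ gt₃)

    A : ℕ
    A = _∣_.quotient y₁∣N

    N≡A*y₁ : N ≡ A ℕ.* y₁
    N≡A*y₁ = _∣_.equality y₁∣N

    private
      G₁₂ : lcm y₁ y₂ ≡ N × ∃ λ s → x s ≡ z₁₂ × GreatestType x s i₁ × GreatestType x s i₂
      G₁₂ = G m i₁ i₂ gt₁ gt₂ y₁≢y₂
      G₁₃ : lcm y₁ y₃ ≡ N × ∃ λ s → x s ≡ z₁₃ × GreatestType x s i₁ × GreatestType x s i₃
      G₁₃ = G m i₁ i₃ gt₁ gt₃ y₁≢y₃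
      s₁₂ s₁₃ : Fin n
      s₁₂ = proj₁ (proj₂ G₁₂)
      s₁₃ = proj₁ (proj₂ G₁₃)
      s₁₂≡z₁₂ : x s₁₂ ≡ z₁₂
      s₁₂≡z₁₂ = proj₁ (proj₂ (proj₂ G₁₂))
      s₁₃≡z₁₃ : x s₁₃ ≡ z₁₃
      s₁₃≡z₁₃ = proj₁ (proj₂ (proj₂ G₁₃))
      gt-s₁₂ : GreatestType x s₁₂ i₁
      gt-s₁₂ = proj₁ (proj₂ (proj₂ (proj₂ G₁₂)))
      gt-s₁₃ : GreatestType x s₁₃ i₁
      gt-s₁₃ = proj₁ (proj₂ (proj₂ (proj₂ G₁₃)))

    -- From lcm y₁ Y = N = A y₁ and gcd y₁ Y · lcm y₁ Y = y₁ Y.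
    lcm≡N⇒≡A*gcd : ∀ {Y} → lcm y₁ Y ≡ N → Y ≡ A ℕ.* gcd y₁ Y
    lcm≡N⇒≡A*gcd {Y} lcm≡N = ℕP.*-cancelˡ-≡ Y (A ℕ.* gcd y₁ Y) y₁ (begin
      y₁ ℕ.* Y                       ≡⟨ sym (gcd*lcm y₁ Y) ⟩
      gcd y₁ Y ℕ.* lcm y₁ Y          ≡⟨ cong (gcd y₁ Y ℕ.*_) (trans lcm≡N N≡A*y₁) ⟩
      gcd y₁ Y ℕ.* (A ℕ.* y₁)        ≡⟨ regroup A y₁ (gcd y₁ Y) ⟩
      y₁ ℕ.* (A ℕ.* gcd y₁ Y)        ∎)
      where
      open ≡-Reasoning
      regroup : ∀ a y z → z ℕ.* (a ℕ.* y) ≡ y ℕ.* (a ℕ.* z)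
      regroup = solve-∀ℕ

    y₂≡A*z₁₂ : y₂ ≡ A ℕ.* z₁₂
    y₂≡A*z₁₂ = lcm≡N⇒≡A*gcd (proj₁ G₁₂)

    y₃≡A*z₁₃ : y₃ ≡ A ℕ.* z₁₃
    y₃≡A*z₁₃ = lcm≡N⇒≡A*gcd (proj₁ G₁₃)

    z₂₃≡A*w : z₂₃ ≡ A ℕ.* w
    z₂₃≡A*w = trans (cong₂ gcd y₂≡A*z₁₂ y₃≡A*z₁₃) (sym (c*gcd[m,n]≡gcd[cm,cn] A z₁₂ z₁₃))

    private
      s₁₂≢s₁₃ : ¬ x s₁₂ ≡ x s₁₃
      s₁₂≢s₁₃ s₁₂≡s₁₃ = y₂≢y₃ (begin
        y₂           ≡⟨ y₂≡A*z₁₂ ⟩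
        A ℕ.* z₁₂    ≡⟨ cong (A ℕ.*_) (trans (sym s₁₂≡z₁₂) (trans s₁₂≡s₁₃ s₁₃≡z₁₃)) ⟩
        A ℕ.* z₁₃    ≡⟨ sym y₃≡A*z₁₃ ⟩
        y₃           ∎)
        where open ≡-Reasoning
      G₁ : lcm (x s₁₂) (x s₁₃) ≡ y₁ × ∃ λ s → x s ≡ gcd (x s₁₂) (x s₁₃) × GreatestType x s s₁₂ × GreatestType x s s₁₃
      G₁ = G i₁ s₁₂ s₁₃ gt-s₁₂ gt-s₁₃ s₁₂≢s₁₃
      lcm[s₁₂,s₁₃]≡y₁ : lcm (x s₁₂) (x s₁₃) ≡ y₁
      lcm[s₁₂,s₁₃]≡y₁ = proj₁ G₁
      s : Fin n
      s = proj₁ (proj₂ G₁)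
      s≡gcd : x s ≡ gcd (x s₁₂) (x s₁₃)
      s≡gcd = proj₁ (proj₂ (proj₂ G₁))
      gt-s-s₁₂ : GreatestType x s s₁₂
      gt-s-s₁₂ = proj₁ (proj₂ (proj₂ (proj₂ G₁)))
      gt-s-s₁₃ : GreatestType x s s₁₃
      gt-s-s₁₃ = proj₂ (proj₂ (proj₂ (proj₂ G₁)))

    w≡s : x s ≡ w
    w≡s = trans s≡gcd (cong₂ gcd s₁₂≡z₁₂ s₁₃≡z₁₃)

    Δ³-ξ≡ : ∀ e → Δ³ (ξ e) N y₁ y₂ y₃ ≡ (ξ e A - 1ℤ) * Δ² (ξ e) y₁ z₁₂ z₁₃ w
    Δ³-ξ≡ e = Δ³-ξ-factor e A (λ V → V) N y₁ y₂ y₃ N≡A*y₁ y₂≡A*z₁₂ y₃≡A*z₁₃ z₂₃≡A*w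

    Δ²-ξ-∣′ : ∀ {a b} → a ∣ b → a ≤ b → Δ² (ξ a) y₁ z₁₂ z₁₃ w ∣ℤ Δ² (ξ b) y₁ z₁₂ z₁₃ w
    Δ²-ξ-∣′ a∣b a≤b =
      Δ²-ξ-∣ y₁ z₁₂ z₁₃ w a∣b a≤b (subst (1 ≤_) w≡s (pos s)) (trans (cong₂ lcm (sym s₁₂≡z₁₂) (sym s₁₃≡z₁₃)) lcm[s₁₂,s₁₃]≡y₁) refl

    Δ²-lcm-∣′ : ∀ {a b} → a ∣ b → a ≤ b → ∀ l → Δ² (ξ a) y₁ z₁₂ z₁₃ w ∣ℤ Δ² (λ M → ξ b (lcm (x l) M)) y₁ z₁₂ z₁₃ w
    Δ²-lcm-∣′ {a} {b} a∣b a≤b l = subst (λ (p , q , r) → Δ² (ξ a) y₁ p q r ∣ℤ Δ² (λ M → ξ b (lcm (x l) M)) y₁ p q r)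
      (cong₂ _,_ s₁₂≡z₁₂ (cong₂ _,_ s₁₃≡z₁₃ w≡s))
      (GreatestTypeSquare.Δ²-lcm-∣ {l} gt-s₁₂ gt-s₁₃ s₁₂≢s₁₃ lcm[s₁₂,s₁₃]≡y₁ s≡gcd gt-s-s₁₂ gt-s-s₁₃ b a∣b a≤b)

    module _ {a b} (a∣b : a ∣ b) (a≤b : a ≤ b) (l : Fin n) where

      private
        L : ℕ
        L = x l
        Δ³-ξ-∣ : Δ³ (ξ a) N y₁ y₂ y₃ ∣ℤ Δ³ (ξ b) N y₁ y₂ y₃
        Δ³-ξ-∣ = subst₂ _∣ℤ_ (sym (Δ³-ξ≡ a)) (sym (Δ³-ξ≡ b)) (*-pres-∣ℤ ([x^a-1]∣[x^b-1] A a∣b) (Δ²-ξ-∣′ a∣b a≤b))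

      Δ³-gcd-∣ : gcd L N ≡ N ⊎ gcd L N ∣ y₁ → Δ³ (ξ a) N y₁ y₂ y₃ ∣ℤ Δ³ (λ M → ξ b (gcd L M)) N y₁ y₂ y₃
      Δ³-gcd-∣ (inj₁ gcd≡N) =
        subst (Δ³ (ξ a) N y₁ y₂ y₃ ∣ℤ_) (Δ³-cong-∣ y₁∣N y₂∣N y₃∣N (λ M∣N → cong (ξ b) (sym (gcd≡ M∣N)))) Δ³-ξ-∣
        where
        gcd≡ : ∀ {M} → M ∣ N → gcd L M ≡ M
        gcd≡ {M} M∣N = trans (gcd-comm L M) (m∣n⇒gcd[m,n]≡m (∣-trans M∣N (subst (_∣ L) gcd≡N (gcd[m,n]∣m L N))))
      Δ³-gcd-∣ (inj₂ gcd∣y₁) = ∣ℤ-≡0 (Δ³-degenerate h N y₁ y₂ y₃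
          (trans (restrict ∣-refl) (cong h (m∣n⇒gcd[m,n]≡m y₁∣N)))
          (restrict y₂∣N) (restrict y₃∣N)
          (trans (restrict (∣-trans (gcd[m,n]∣m y₂ y₃) y₂∣N)) (cong h (gcd[a,gcd[b,c]]≡gcd₃ y₁ y₂ y₃))))
        where
        h : ℕ → ℤ
        h M = ξ b (gcd L M)
        restrict : ∀ {Y} → Y ∣ N → h Y ≡ h (gcd y₁ Y)
        restrict Y∣N = cong (ξ b) (gcd-restrict {L} gcd∣y₁ Y∣N)

      Δ³-lcm-∣ : gcd L N ≡ N ⊎ gcd L N ∣ y₁ → Δ³ (ξ a) N y₁ y₂ y₃ ∣ℤ Δ³ (λ M → ξ b (lcm L M)) N y₁ y₂ y₃
      Δ³-lcm-∣ (inj₁ gcd≡N) =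
        ∣ℤ-≡0 (trans (Δ³-cong-∣ y₁∣N y₂∣N y₃∣N const) (Δ³-degenerate (λ _ → ξ b L) N y₁ y₂ y₃ refl refl refl refl))
        where
        const : ∀ {M} → M ∣ N → ξ b (lcm L M) ≡ ξ b L
        const M∣N = cong (ξ b) (∣-antisym (lcm-least ∣-refl (∣-trans M∣N (subst (_∣ L) gcd≡N (gcd[m,n]∣m L N)))) (m∣lcm[m,n] L _))
      Δ³-lcm-∣ (inj₂ gcd∣y₁) = subst₂ _∣ℤ_ (sym (Δ³-ξ≡ a)) (sym factored) (*-pres-∣ℤ ([x^a-1]∣[x^b-1] A a∣b) (Δ²-lcm-∣′ a∣b a≤b l))
        where
        restrict : ∀ {Y} → Y ∣ N → gcd L Y ≡ gcd L (gcd y₁ Y)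
        restrict = gcd-restrict {L} gcd∣y₁
        factored : Δ³ (λ M → ξ b (lcm L M)) N y₁ y₂ y₃ ≡ (ξ b A - 1ℤ) * Δ² (λ M → ξ b (lcm L M)) y₁ z₁₂ z₁₃ w
        factored = Δ³-ξ-factor b A (lcm L) N y₁ y₂ y₃
          (lcm-scale {A = A} (pos l) (trans (restrict ∣-refl) (cong (gcd L) (m∣n⇒gcd[m,n]≡m y₁∣N))) N≡A*y₁)
          (lcm-scale {A = A} (pos l) (restrict y₂∣N) y₂≡A*z₁₂)
          (lcm-scale {A = A} (pos l) (restrict y₃∣N) y₃≡A*z₁₃)
          (lcm-scale {A = A} (pos l) (trans (restrict (∣-trans (gcd[m,n]∣m y₂ y₃) y₂∣N)) (cong (gcd L) (gcd[a,gcd[b,c]]≡gcd₃ y₁ y₂ y₃))) z₂₃≡A*w)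

-- α and the sums Σ c_{rm} h(x_r) as inclusion–exclusion over G_S(x_m)

module ExactlyThreeGreatestType {n : ℕ} (x : Fin n → ℕ) (inj : Injective _≡_ _≡_ x) (pos : ∀ i → 0 < x i)
  (gc : GcdClosed x) (G : SatisfiesG x) {m i j k : Fin n}
  (gt-i : GreatestType x i m) (gt-j : GreatestType x j m) (gt-k : GreatestType x k m)
  (i≢j : ¬ x i ≡ x j) (i≢k : ¬ x i ≡ x k) (j≢k : ¬ x j ≡ x k)
  (only : ∀ t → GreatestType x t m → (x t ≡ x i) ⊎ (x t ≡ x j) ⊎ (x t ≡ x k)) where

  open GcdClosedSet x pos gc G

  N y₁ y₂ y₃ : ℕ
  N = x m ; y₁ = x i ; y₂ = x j ; y₃ = x k

  private
    y₁∣N : y₁ ∣ N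
    y₁∣N = proj₁ (proj₂ gt-i)
    y₂∣N : y₂ ∣ N
    y₂∣N = proj₁ (proj₂ gt-j)
    y₃∣N : y₃ ∣ N
    y₃∣N = proj₁ (proj₂ gt-k)

    1≤∣N : ∀ {M} → M ∣ N → 1 ≤ M
    1≤∣N {zero}  0∣N = ⊥-elim (ℕP.<⇒≢ (pos m) (sym (0∣⇒≡0 0∣N)))
    1≤∣N {suc _} _   = s≤s z≤n

  -- A divisor of N dividing a smaller x_t ∈ S divides gcd(x_t, N) < N, hence lies below a greatest-type divisor.
  noSmaller⇔ : ∀ e → (e ∣ N × NoSmaller x m e) ⇔ (e ∣ N × ¬ e ∣ y₁ × ¬ e ∣ y₂ × ¬ e ∣ y₃)
  noSmaller⇔ e = mk⇔ (λ (e∣N , ns) → e∣N , ns i (proj₁ gt-i) , ns j (proj₁ gt-j) , ns k (proj₁ gt-k))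
                     (λ (e∣N , e∤y₁ , e∤y₂ , e∤y₃) → e∣N , noSmaller e∣N e∤y₁ e∤y₂ e∤y₃)
    where
    noSmaller : e ∣ N → ¬ e ∣ y₁ → ¬ e ∣ y₂ → ¬ e ∣ y₃ → NoSmaller x m e
    noSmaller e∣N e∤y₁ e∤y₂ e∤y₃ t t<m e∣t with gc t m
    ... | g , g≡gcd with ∃greatestType-above m g (subst (_∣ N) (sym g≡gcd) (gcd[m,n]∣n (x t) N))
                            (ℕP.≤-<-trans (ℕP.≤-trans (ℕP.≤-reflexive g≡gcd) (∣⇒≤ {{x≢0 {t}}} (gcd[m,n]∣m (x t) N))) t<m)
    ...   | t′ , gt′ , g∣t′ = excluded (only t′ gt′) (∣-trans (subst (e ∣_) (sym g≡gcd) (gcd-greatest e∣t e∣N)) g∣t′)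
      where
      excluded : ∀ {M} → (M ≡ y₁) ⊎ (M ≡ y₂) ⊎ (M ≡ y₃) → ¬ e ∣ M
      excluded (inj₁ refl)        = e∤y₁
      excluded (inj₂ (inj₁ refl)) = e∤y₂
      excluded (inj₂ (inj₂ refl)) = e∤y₃

  χ-noSmaller≡Δ³ : ∀ e v → χ (does ((e ∣? N) ×-dec noSmaller? x m e)) v ≡ Δ³ (λ M → χ (does (e ∣? M)) v) N y₁ y₂ y₃
  χ-noSmaller≡Δ³ e v =
    trans (cong (λ b → χ b v) (does-⇔ (noSmaller⇔ e) ((e ∣? N) ×-dec noSmaller? x m e)
                                                   ((e ∣? N) ×-dec ¬? (e ∣? y₁) ×-dec ¬? (e ∣? y₂) ×-dec ¬? (e ∣? y₃))))
          (χ∣-inclusion-exclusion e v y₁∣N y₂∣N y₃∣N)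

  α≡Δ³ : ∀ a → α x a m ≡ Δ³ (ξ a) N y₁ y₂ y₃
  α≡Δ³ a = begin
    α x a m
      ≡⟨ Σℤ-map-filter (λ d → (d ∣? N) ×-dec noSmaller? x m d) (ξ*μ a) [1‥ N ] ⟩
    Σℤ (map (λ d → χ (does ((d ∣? N) ×-dec noSmaller? x m d)) (ξ*μ a d)) [1‥ N ])
      ≡⟨ Σℤ-[1‥] _ N ⟩
    Σ[1‥ N ] (λ d → χ (does ((d ∣? N) ×-dec noSmaller? x m d)) (ξ*μ a d))
      ≡⟨ Σ-cong N (λ d _ _ → χ-noSmaller≡Δ³ d (ξ*μ a d)) ⟩
    Σ[1‥ N ] (λ d → Δ³ (λ M → χ (does (d ∣? M)) (ξ*μ a d)) N y₁ y₂ y₃)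
      ≡⟨ additive-Δ³ (Σ[1‥_]_ N) (Σ-distrib-+ N) (Σ-distrib-neg N) (λ d M → χ (does (d ∣? M)) (ξ*μ a d)) N y₁ y₂ y₃ ⟩
    Δ³ (λ M → Σ[1‥ N ] (λ d → χ (does (d ∣? M)) (ξ*μ a d))) N y₁ y₂ y₃
      ≡⟨ Δ³-cong-∣ y₁∣N y₂∣N y₃∣N (λ M∣N → Σ-divisors-ξ*μ a _ N (1≤∣N M∣N) (∣⇒≤ M∣N)) ⟩
    Δ³ (ξ a) N y₁ y₂ y₃ ∎
    where open ≡-Reasoning

  c≡Δ³ : ∀ r → c x r m ≡ Δ³ (λ M → χ (does (x r ℕ.≟ M)) 1ℤ) N y₁ y₂ y₃
  c≡Δ³ r = begin
    c x r m
      ≡⟨ Σℤ-map-filter (λ d → (d ℕ.* x r ∣? N) ×-dec noSmaller? x m (d ℕ.* x r)) μ [1‥ N ] ⟩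
    Σℤ (map (λ d → χ (does ((d ℕ.* x r ∣? N) ×-dec noSmaller? x m (d ℕ.* x r))) (μ d)) [1‥ N ])
      ≡⟨ Σℤ-[1‥] _ N ⟩
    Σ[1‥ N ] (λ d → χ (does ((d ℕ.* x r ∣? N) ×-dec noSmaller? x m (d ℕ.* x r))) (μ d))
      ≡⟨ Σ-cong N (λ d _ _ → χ-noSmaller≡Δ³ (d ℕ.* x r) (μ d)) ⟩
    Σ[1‥ N ] (λ d → Δ³ (λ M → χ (does (d ℕ.* x r ∣? M)) (μ d)) N y₁ y₂ y₃)
      ≡⟨ additive-Δ³ (Σ[1‥_]_ N) (Σ-distrib-+ N) (Σ-distrib-neg N) (λ d M → χ (does (d ℕ.* x r ∣? M)) (μ d)) N y₁ y₂ y₃ ⟩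
    Δ³ (λ M → Σ[1‥ N ] (λ d → χ (does (d ℕ.* x r ∣? M)) (μ d))) N y₁ y₂ y₃
      ≡⟨ Δ³-cong-∣ y₁∣N y₂∣N y₃∣N (λ M∣N → Σμ-multiples (x r) _ N (pos r) (1≤∣N M∣N) (∣⇒≤ M∣N)) ⟩
    Δ³ (λ M → χ (does (x r ℕ.≟ M)) 1ℤ) N y₁ y₂ y₃ ∎
    where open ≡-Reasoning

  Σc*h≡Δ³ : ∀ (h : ℕ → ℤ) → Σℤ (map (λ r → c x r m * h (x r)) (divIdx x m)) ≡ Δ³ h N y₁ y₂ y₃
  Σc*h≡Δ³ h = begin
    Σℤ (map (λ r → c x r m * h (x r)) (divIdx x m))
      ≡⟨ Σℤ-map-filter (λ r → x r ∣? N) _ (allFin n) ⟩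
    Σℤ (map (λ r → χ (does (x r ∣? N)) (c x r m * h (x r))) (allFin n))
      ≡⟨ cong Σℤ (ListP.map-cong term≡Δ³ (allFin n)) ⟩
    Σℤ (map (λ r → Δ³ (term r) N y₁ y₂ y₃) (allFin n))
      ≡⟨ additive-Δ³ (λ f → Σℤ (map f (allFin n))) (Σℤ-map-+ (allFin n)) (Σℤ-map-neg (allFin n)) term N y₁ y₂ y₃ ⟩
    Δ³ (λ M → Σℤ (map (λ r → term r M) (allFin n))) N y₁ y₂ y₃
      ≡⟨ Δ³-cong InS∣N (λ (u∣N , u∈S) (v∣N , v∈S) → ∣-trans (gcd[m,n]∣m _ _) u∣N , ∈S-gcd u∈S v∈S)
                 (∣-refl , m , refl) (y₁∣N , i , refl) (y₂∣N , j , refl) (y₃∣N , k , refl) Σterm≡h ⟩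
    Δ³ h N y₁ y₂ y₃ ∎
    where
    open ≡-Reasoning
    term : Fin n → ℕ → ℤ
    term r M = χ (does (x r ∣? N)) (χ (does (x r ℕ.≟ M)) 1ℤ * h (x r))
    term≡Δ³ : ∀ r → χ (does (x r ∣? N)) (c x r m * h (x r)) ≡ Δ³ (term r) N y₁ y₂ y₃
    term≡Δ³ r = trans (cong (χ (does (x r ∣? N)))
                            (trans (cong (_* h (x r)) (c≡Δ³ r)) (sym (Δ³-*ʳ (λ M → χ (does (x r ℕ.≟ M)) 1ℤ) (h (x r)) N y₁ y₂ y₃))))
                      (χ-Δ³ (does (x r ∣? N)) (λ M → χ (does (x r ℕ.≟ M)) 1ℤ * h (x r)) N y₁ y₂ y₃)
    InS∣N : ℕ → Set
    InS∣N M = M ∣ N × ∃ λ t → x t ≡ M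
    ∈S-gcd : ∀ {u v} → (∃ λ t → x t ≡ u) → (∃ λ t → x t ≡ v) → ∃ λ t → x t ≡ gcd u v
    ∈S-gcd (t₁ , refl) (t₂ , refl) = gc t₁ t₂
    Σterm≡h : ∀ {M} → InS∣N M → Σℤ (map (λ r → term r M) (allFin n)) ≡ h M
    Σterm≡h {M} (M∣N , t , refl) = trans (Σℤ-allFin-single n (λ r → term r M) t off) on
      where
      off : ∀ r → ¬ r ≡ t → term r M ≡ 0ℤ
      off r r≢t = trans (cong (χ (does (x r ∣? N))) (trans (cong (_* h (x r)) (χ-dec-false (x r ℕ.≟ M) (λ x≡ → r≢t (inj x≡)))) (ℤP.*-zeroˡ (h (x r)))))
                        (χ-zero (does (x r ∣? N)))
      on : term t M ≡ h M
      on = trans (χ-dec-true (x t ∣? N) M∣N) (trans (cong (_* h M) (χ-dec-true (x t ℕ.≟ M) refl)) (ℤP.*-identityˡ (h M)))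

  module _ {a b} (a∣b : a ∣ b) (a≤b : a ≤ b) (l : Fin n) where

    private
      L : ℕ
      L = x l

      Δ³-∣gcd,lcm : ℕ → ℕ → ℕ → Set
      Δ³-∣gcd,lcm u v w = (Δ³ (ξ a) N u v w ∣ℤ Δ³ (λ M → ξ b (gcd L M)) N u v w) × (Δ³ (ξ a) N u v w ∣ℤ Δ³ (λ M → ξ b (lcm L M)) N u v w)

      permute : ∀ {u v w u′ v′ w′} → (∀ h → Δ³ h N u′ v′ w′ ≡ Δ³ h N u v w) → Δ³-∣gcd,lcm u′ v′ w′ → Δ³-∣gcd,lcm u v w
      permute Δ³≡ (∣gcd , ∣lcm) = subst₂ _∣ℤ_ (Δ³≡ (ξ a)) (Δ³≡ (λ M → ξ b (gcd L M))) ∣gcd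
                               , subst₂ _∣ℤ_ (Δ³≡ (ξ a)) (Δ³≡ (λ M → ξ b (lcm L M))) ∣lcm

      ordered : ∀ {p q r} (gt-p : GreatestType x p m) (gt-q : GreatestType x q m) (gt-r : GreatestType x r m) →
        ¬ x p ≡ x q → ¬ x p ≡ x r → ¬ x q ≡ x r → gcd L N ≡ N ⊎ gcd L N ∣ x p → Δ³-∣gcd,lcm (x p) (x q) (x r)
      ordered gt-p gt-q gt-r p≢q p≢r q≢r case = T.Δ³-gcd-∣ a∣b a≤b l case , T.Δ³-lcm-∣ a∣b a≤b l case
        where module T = ThreeGreatestType gt-p gt-q gt-r p≢q p≢r q≢r

      below : ∀ {Y} → (Y ≡ y₁) ⊎ (Y ≡ y₂) ⊎ (Y ≡ y₃) → gcd L N ∣ Y → Δ³-∣gcd,lcm y₁ y₂ y₃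
      below (inj₁ refl)        gcd∣ = ordered gt-i gt-j gt-k i≢j i≢k j≢k (inj₂ gcd∣)
      below (inj₂ (inj₁ refl)) gcd∣ =
        permute (λ h → Δ³-swap₁₂ h N y₁ y₂ y₃) (ordered gt-j gt-i gt-k (λ e → i≢j (sym e)) j≢k i≢k (inj₂ gcd∣))
      below (inj₂ (inj₂ refl)) gcd∣ =
        permute (λ h → Δ³-rotate h N y₁ y₂ y₃) (ordered gt-k gt-i gt-j (λ e → i≢k (sym e)) (λ e → j≢k (sym e)) i≢j (inj₂ gcd∣))

    -- gcd L N ∈ S is either N or lies below one of y₁, y₂, y₃.
    Δ³-∣ : Δ³-∣gcd,lcm y₁ y₂ y₃
    Δ³-∣ with gc l m
    ... | u , u≡gcd with x u ℕ.≟ N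
    ...   | yes u≡N = ordered gt-i gt-j gt-k i≢j i≢k j≢k (inj₁ (trans (sym u≡gcd) u≡N))
    ...   | no  u≢N with ∃greatestType-above m u u∣N (ℕP.≤∧≢⇒< (∣⇒≤ₓ u∣N) u≢N)
      where
      u∣N : x u ∣ N
      u∣N = subst (_∣ N) (sym u≡gcd) (gcd[m,n]∣n L N)
    ...     | t , gt-t , u∣t = below (only t gt-t) (subst (_∣ x t) u≡gcd u∣t)

lemma2p17 : (n : ℕ) (x : Fin n → ℕ) → Injective _≡_ _≡_ x → (∀ i → 0 < x i) →
    GcdClosed x → SatisfiesG x → (l m : Fin n) → HasThreeGTD x m →
    (a b : ℕ) → 0 < a → 0 < b → a ∣ b →
    (∃ λ (f : ℤ) → f * α x a m ≡ sumGcd x b l m) ×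
    (∃ λ (g : ℤ) → g * α x a m ≡ sumLcm x b l m)
lemma2p17 n x inj pos gc G l m (i , j , k , i≢j , i≢k , j≢k , gt-i , gt-j , gt-k , only) a b _ 0<b a∣b =
  quotient (α≡Δ³ a) (Σc*h≡Δ³ (λ M → ξ b (gcd (x l) M))) (proj₁ (Δ³-∣ a∣b a≤b l)) ,
  quotient (α≡Δ³ a) (Σc*h≡Δ³ (λ M → ξ b (lcm (x l) M))) (proj₂ (Δ³-∣ a∣b a≤b l))
  where
  open ExactlyThreeGreatestType x inj pos gc G gt-i gt-j gt-k i≢j i≢k j≢k only
  a≤b : a ≤ b
  a≤b = ∣⇒≤ {{ℕ.>-nonZero 0<b}} a∣b
  quotient : ∀ {α′ s D S} → α′ ≡ D → s ≡ S → D ∣ℤ S → ∃ λ (q : ℤ) → q * α′ ≡ s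
  quotient refl refl (ℤ∣.divides q S≡qD) = q , sym S≡qD
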